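{- Let $k$ be a field of characteristic zero. If $1+s_1t+s_2t^2+\cdots$ is the Poincar\'e series of a free graded commutative algebra $S^\bullet(V)$ generated by a graded $k$-vector space $V^\bullet=\bigoplus_{i\ge1}V^i$ with finite-dimensional components, then for every integer $N\ge 1$ the sequence $\underline{s}=(s_1,s_2,\dots)$ satisfies \[ (-1)^{N+1}\sum_{d\mid N}\mu(N/d)\,p_d(\underline{s})\ge 0, \] where the sum is over all positive divisors $d$ of $N$ and $\mu$ is the M\"obius function.
   Context: The Poincar\'e series of a graded algebra $A^\bullet$ with finite-dimensional components is $\sum_i\dim_k A^i t^i$. The free graded commutative algebra is $S^\bullet(V)=\bigotimes_{i\text{ even}}\mathrm{Sym}^\bullet(V^i)\otimes\bigotimes_{i\text{ odd}}\Lambda^\bullet(V^i)$, with elements of $V^i$ in degree $i$. For indeterminates $s_1,s_2,\dots$, $p_d(\underline{s})$ is the unique polynomial in $s_1,\dots,s_d$ such that whenever $s_i=\sigma_i(\gamma_1,\dots,\gamma_M)$ are the elementary symmetric polynomials in variables $\gamma_1,\dots,\gamma_M$ ($M\ge d$), $p_d(\underline{s})=\gamma_1^d+\cdots+\gamma_M^d$ (e.g. $p_1=s_1$, $p_2=s_1^2-2s_2$). The M\"obius function is $\mu(n)=(-1)^k$ if $n$ is a product of $k$ distinct primes and $\mu(n)=0$ otherwise. -}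

module Defs where

open import Data.Bool using (Bool; true; false; if_then_else_)
open import Data.Nat as ℕ using (ℕ; zero; suc; _∸_; _≡ᵇ_)
open import Data.Nat.DivMod using (_/_; _%_)
open import Data.Nat.Divisibility using (_∣?_)
open import Data.Nat.Primality using (prime?)
open import Data.Nat.Combinatorics using (_C_)
open import Data.List using (List; []; _∷_; upTo; filter; length; map; foldr)
open import Data.Nat.ListAction using (sum)
open import Data.Bool.ListAction using (any)
open import Data.Integer as ℤ using (ℤ; +_; -_; _*_; _+_)
open import Relation.Nullary using (does)

-- Graded vector spaces with finite-dimensional components are recorded
-- by their dimension sequences  ℕ → ℕ  (entry n = dim of degree-n part).

-- Graded tensor product: (A ⊗ B)^n = ⊕_{j ≤ n} A^j ⊗ B^(n-j).
conv : (ℕ → ℕ) → (ℕ → ℕ) → ℕ → ℕ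
conv f g n = sum (map (λ j → f j ℕ.* g (n ∸ j)) (upTo (suc n)))

unitSeries : ℕ → ℕ
unitSeries zero    = 1
unitSeries (suc _) = 0

dimSym : ℕ → ℕ → ℕ
dimSym m a = (m ℕ.+ a ∸ 1) C a

dimΛ : ℕ → ℕ → ℕ
dimΛ m a = m C a

-- Graded dimensions of Sym^•(V^i) (i even) resp. Λ^•(V^i) (i odd) where
-- dim V^i = m and elements of V^i have degree i = suc j:
-- the degree-n part is the a-th power with n = a·i, and 0 if i ∤ n.
isEven : ℕ → Bool
isEven zero = true
isEven (suc n) = not' (isEven n)
  where
  not' : Bool → Bool
  not' true = false
  not' false = true

factorSeries : (m j : ℕ) → ℕ → ℕ
factorSeries m j n =
  if (n % suc j) ≡ᵇ 0
  then (if isEven (suc j) then dimSym m (n / suc j) else dimΛ m (n / suc j))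
  else 0

-- Graded dimensions of ⊗_{1 ≤ i ≤ r} (Sym or Λ)(V^i), with v i = dim V^i.
partialS : (v : ℕ → ℕ) → ℕ → ℕ → ℕ
partialS v zero    = unitSeries
partialS v (suc r) = conv (partialS v r) (factorSeries (v (suc r)) r)

-- dim S^n(V): factors with i > n contribute only in degree 0, so the
-- degree-n part of S^•(V) equals that of the finite tensor product over i ≤ n.
dimS : (v : ℕ → ℕ) → ℕ → ℕ
dimS v n = partialS v n n

sgn : ℕ → ℤ
sgn zero    = + 1
sgn (suc k) = - sgn k

-- Möbius function, literally: 0 if n has a square factor d² with d ≥ 2,
-- otherwise (-1)^(number of distinct primes dividing n).  (Used for n ≥ 1.)
hasSquareFactor : ℕ → Bool
hasSquareFactor n =
  any (λ d → does ((suc (suc d) ℕ.* suc (suc d)) ∣? n)) (upTo n)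

numPrimeDivisors : ℕ → ℕ
numPrimeDivisors n =
  length (filter (λ p → prime? p Relation.Nullary.×-dec (p ∣? n)) (upTo (suc n)))
  where import Relation.Nullary

möbius : ℕ → ℤ
möbius n = if hasSquareFactor n then + 0 else sgn (numPrimeDivisors n)

-- Power sums p_d(s) in terms of elementary symmetric values s_i, via
-- Newton's identities:
--   p_d = Σ_{i=1}^{d-1} (-1)^{i-1} s_i p_{d-i} + (-1)^{d-1} d s_d .
-- powerSumsRev s d = [p_d, p_{d-1}, …, p_1].
newtonSum : (ℕ → ℤ) → ℕ → List ℤ → ℤ
newtonSum s i []       = + 0
newtonSum s i (x ∷ xs) = sgn (i ∸ 1) * s i * x + newtonSum s (suc i) xs

powerSumsRev : (ℕ → ℤ) → ℕ → List ℤ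
powerSumsRev s zero    = []
powerSumsRev s (suc d) =
  (newtonSum s 1 (powerSumsRev s d) + sgn d * (+ suc d) * s (suc d))
  ∷ powerSumsRev s d

-- p_d(s) for d ≥ 1 (value at d = 0 is an unused placeholder).
powerSum : (ℕ → ℤ) → ℕ → ℤ
powerSum s d with powerSumsRev s d
... | []    = + 0
... | x ∷ _ = x

möbiusPowerSum : (ℕ → ℤ) → ℕ → ℤ
möbiusPowerSum s N =
  foldr _+_ (+ 0) (map (λ j → if does (suc j ∣? N)
                             then möbius (N / suc j) * powerSum s (suc j)
                             else + 0)
                     (upTo N))

-- If P(t) = ∏ (1 + γₖ t) is the Poincaré series, its logarithmic derivative t P′ / P is
-- Σₑ (−1)^(e+1) pₑ tᵉ.  On the other hand P(t) = ∏ᵢ (1 − εᵢ tⁱ)^(−εᵢ vᵢ) with εᵢ = (−1)ⁱ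
-- (symmetric powers for even i, exterior powers for odd i), so t P′ / P = Σᵢ i vᵢ tⁱ / (1 − εᵢ tⁱ).
-- Comparing coefficients gives pₑ = Σ_{i∣e} (−1)^(i+1) i vᵢ, and Möbius inversion turns this into
-- Σ_{d∣N} μ(N/d) p_d = (−1)^(N+1) N v_N, so the signed sum is N v_N ≥ 0.
--
-- Sequences ℕ → ℤ serve as formal power series under the Cauchy product _⋆_, with θ F n = n F n
-- playing the role of t d/dt; the Newton recursion by which p_d is defined is matched against
-- θ S = S ⋆ r for the Poincaré series S.

module Submission where

open import Data.Bool using (Bool; true; false; if_then_else_; T)
open import Data.Bool.Properties using (T-≡)
open import Data.Empty using (⊥-elim)
open import Data.List using (List; []; _∷_; applyUpTo; upTo; filter; length; map; foldr)
open import Data.Nat using (ℕ; zero; suc; _∸_; _≤_; _<_; z≤n; s≤s; NonZero)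
import Data.Nat as ℕ
import Data.Nat.Properties as ℕ
open import Data.Nat.Combinatorics using (_C_; nC1≡n; nCk+nC[k+1]≡[n+1]C[k+1]; k>n⇒nCk≡0)
import Data.Nat.Tactic.RingSolver as ℕ-Solver
open import Data.Nat.DivMod using (_/_; _%_; m*n/n≡m; m*n%n≡0; m*n/o*n≡m/o)
open import Data.Nat.Divisibility
open import Data.Nat.Coprimality using (Coprime; coprime-divisor)
open import Data.Nat.Primality
open import Data.Nat.Primality.Factorisation using (factorise)
open import Data.Nat.ListAction using (sum; product)
open import Data.Integer as ℤ using (ℤ; +_; -_; _+_; _*_; _-_; -1ℤ) renaming (_≤_ to _≤ℤ_)
import Data.Integer.Properties as ℤ
open import Data.Integer.Tactic.RingSolver using (solve-∀)
open import Data.List.Relation.Unary.All using (_∷_)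
open import Data.List.Relation.Unary.Any.Properties using (any⁺; any⁻; applyUpTo⁺; applyUpTo⁻)
open import Data.Product using (∃-syntax; _×_; _,_; proj₂)
open import Data.Sum using (inj₁; inj₂; [_,_]; reduce)
open import Function using (_∘_; id; Equivalence)
open import Relation.Binary.PropositionalEquality hiding ([_])
open import Relation.Nullary using (¬_; Dec; yes; no; does; _×-dec_)
open import Relation.Nullary.Decidable using (¬?)
open import Algebra.Properties.AbelianGroup ℤ.+-0-abelianGroup using () renaming (∙-cancelʳ to +-cancelʳ)

open import Defs

open ≡-Reasoning

∑ : ℕ → (ℕ → ℤ) → ℤ
∑ zero    f = + 0
∑ (suc n) f = f 0 + ∑ n (f ∘ suc)

infixl 10 ∑
syntax ∑ n (λ j → e) = ∑[ j < n ] e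

∑-cong< : ∀ n {f g : ℕ → ℤ} → (∀ j → j < n → f j ≡ g j) → ∑ n f ≡ ∑ n g
∑-cong< zero    eq = refl
∑-cong< (suc n) eq = cong₂ _+_ (eq 0 (s≤s z≤n)) (∑-cong< n (λ j j<n → eq (suc j) (s≤s j<n)))

∑-cong : ∀ n {f g : ℕ → ℤ} → (∀ j → f j ≡ g j) → ∑ n f ≡ ∑ n g
∑-cong n eq = ∑-cong< n (λ j _ → eq j)

∑-≡0 : ∀ n {f : ℕ → ℤ} → (∀ j → j < n → f j ≡ + 0) → ∑ n f ≡ + 0
∑-≡0 zero    eq = refl
∑-≡0 (suc n) eq = cong₂ _+_ (eq 0 (s≤s z≤n)) (∑-≡0 n (λ j j<n → eq (suc j) (s≤s j<n)))

∑-distrib-+ : ∀ n (f g : ℕ → ℤ) → ∑[ j < n ] (f j + g j) ≡ ∑ n f + ∑ n g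
∑-distrib-+ zero    f g = refl
∑-distrib-+ (suc n) f g = trans (cong (_+_ (f 0 + g 0)) (∑-distrib-+ n (f ∘ suc) (g ∘ suc)))
                                (interchange (f 0) (g 0) _ _)
  where
  interchange : ∀ a b c d → (a + b) + (c + d) ≡ (a + c) + (b + d)
  interchange = solve-∀

*-distribˡ-∑ : ∀ n c (f : ℕ → ℤ) → c * ∑ n f ≡ ∑[ j < n ] (c * f j)
*-distribˡ-∑ zero    c f = ℤ.*-zeroʳ c
*-distribˡ-∑ (suc n) c f = trans (ℤ.*-distribˡ-+ c (f 0) _) (cong (_+_ (c * f 0)) (*-distribˡ-∑ n c (f ∘ suc)))

*-distribʳ-∑ : ∀ n c (f : ℕ → ℤ) → ∑ n f * c ≡ ∑[ j < n ] (f j * c)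
*-distribʳ-∑ n c f = begin
  ∑ n f * c              ≡⟨ ℤ.*-comm (∑ n f) c ⟩
  c * ∑ n f              ≡⟨ *-distribˡ-∑ n c f ⟩
  ∑[ j < n ] (c * f j)   ≡⟨ ∑-cong n (λ j → ℤ.*-comm c (f j)) ⟩
  ∑[ j < n ] (f j * c)   ∎

∑-split : ∀ m n (f : ℕ → ℤ) → ∑ (m ℕ.+ n) f ≡ ∑ m f + ∑[ j < n ] f (m ℕ.+ j)
∑-split zero    n f = sym (ℤ.+-identityˡ _)
∑-split (suc m) n f = trans (cong (_+_ (f 0)) (∑-split m n (f ∘ suc))) (sym (ℤ.+-assoc (f 0) _ _))

∑-init-last : ∀ n (f : ℕ → ℤ) → ∑ (suc n) f ≡ ∑ n f + f n
∑-init-last zero    f = trans (ℤ.+-identityʳ (f 0)) (sym (ℤ.+-identityˡ (f 0)))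
∑-init-last (suc n) f = trans (cong (_+_ (f 0)) (∑-init-last n (f ∘ suc))) (sym (ℤ.+-assoc (f 0) _ _))

∑-concentrated : ∀ n k {f : ℕ → ℤ} → k < n → (∀ j → j < n → j ≢ k → f j ≡ + 0) → ∑ n f ≡ f k
∑-concentrated (suc n) zero    {f} _         off = begin
  f 0 + ∑ n (f ∘ suc)  ≡⟨ cong (_+_ (f 0)) (∑-≡0 n (λ j j<n → off (suc j) (s≤s j<n) (λ ()))) ⟩
  f 0 + + 0            ≡⟨ ℤ.+-identityʳ (f 0) ⟩
  f 0                  ∎
∑-concentrated (suc n) (suc k) {f} (s≤s k<n) off = begin
  f 0 + ∑ n (f ∘ suc)  ≡⟨ cong (_+ ∑ n (f ∘ suc)) (off 0 (s≤s z≤n) (λ ())) ⟩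
  + 0 + ∑ n (f ∘ suc)  ≡⟨ ℤ.+-identityˡ _ ⟩
  ∑ n (f ∘ suc)        ≡⟨ ∑-concentrated n k k<n (λ j j<n j≢k → off (suc j) (s≤s j<n) (j≢k ∘ ℕ.suc-injective)) ⟩
  f (suc k)            ∎

∑-truncate : ∀ m n {f : ℕ → ℤ} → m ≤ n → (∀ j → m ≤ j → j < n → f j ≡ + 0) → ∑ n f ≡ ∑ m f
∑-truncate m n {f} m≤n tail = begin
  ∑ n f                                   ≡⟨ cong (λ k → ∑ k f) (sym (ℕ.m+[n∸m]≡n m≤n)) ⟩
  ∑ (m ℕ.+ (n ∸ m)) f                     ≡⟨ ∑-split m (n ∸ m) f ⟩
  ∑ m f + ∑[ j < n ∸ m ] f (m ℕ.+ j)      ≡⟨ cong (_+_ (∑ m f)) (∑-≡0 (n ∸ m) tail′) ⟩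
  ∑ m f + + 0                             ≡⟨ ℤ.+-identityʳ _ ⟩
  ∑ m f                                   ∎
  where
  tail′ : ∀ j → j < n ∸ m → f (m ℕ.+ j) ≡ + 0
  tail′ j j<n∸m = tail (m ℕ.+ j) (ℕ.m≤m+n m j) (subst (m ℕ.+ j <_) (ℕ.m+[n∸m]≡n m≤n) (ℕ.+-monoʳ-< m j<n∸m))

∑-comm : ∀ m n (f : ℕ → ℕ → ℤ) → ∑[ i < m ] ∑[ j < n ] f i j ≡ ∑[ j < n ] ∑[ i < m ] f i j
∑-comm zero    n f = sym (∑-≡0 n (λ _ _ → refl))
∑-comm (suc m) n f = begin
  ∑ n (f 0) + ∑[ i < m ] ∑[ j < n ] f (suc i) j  ≡⟨ cong (_+_ (∑ n (f 0))) (∑-comm m n (f ∘ suc)) ⟩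
  ∑ n (f 0) + ∑[ j < n ] ∑[ i < m ] f (suc i) j  ≡⟨ sym (∑-distrib-+ n (f 0) _) ⟩
  ∑[ j < n ] ∑[ i < suc m ] f i j                ∎

∑-reverse : ∀ n (f : ℕ → ℤ) → ∑ n f ≡ ∑[ j < n ] f (n ∸ suc j)
∑-reverse zero    f = refl
∑-reverse (suc n) f = begin
  f 0 + ∑ n (f ∘ suc)                      ≡⟨ cong (_+_ (f 0)) (∑-reverse n (f ∘ suc)) ⟩
  f 0 + ∑[ j < n ] f (suc (n ∸ suc j))     ≡⟨ ℤ.+-comm (f 0) _ ⟩
  ∑[ j < n ] f (suc (n ∸ suc j)) + f 0     ≡⟨ cong₂ _+_ (∑-cong< n (λ j j<n → cong f (sym (ℕ.+-∸-assoc 1 j<n))))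
                                                      (cong f (sym (ℕ.n∸n≡0 n))) ⟩
  ∑[ j < n ] f (n ∸ j) + f (n ∸ n)         ≡⟨ sym (∑-init-last n (λ j → f (n ∸ j))) ⟩
  ∑[ j < suc n ] f (n ∸ j)                 ∎

foldr-+-applyUpTo : ∀ (F : ℕ → ℤ) (g : ℕ → ℕ) k → foldr _+_ (+ 0) (map F (applyUpTo g k)) ≡ ∑[ j < k ] F (g j)
foldr-+-applyUpTo F g zero    = refl
foldr-+-applyUpTo F g (suc k) = cong (_+_ (F (g 0))) (foldr-+-applyUpTo F (g ∘ suc) k)

pos-sum-applyUpTo : ∀ (h g : ℕ → ℕ) k → + sum (map h (applyUpTo g k)) ≡ ∑[ j < k ] (+ h (g j))
pos-sum-applyUpTo h g zero    = refl
pos-sum-applyUpTo h g (suc k) = trans (ℤ.pos-+ (h (g 0)) _) (cong (_+_ (+ h (g 0))) (pos-sum-applyUpTo h (g ∘ suc) k))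

⟦_⟧ : ∀ {p} {P : Set p} → Dec P → ℤ
⟦ yes _ ⟧ = + 1
⟦ no  _ ⟧ = + 0

⟦⟧-yes : ∀ {p} {P : Set p} → P → (d : Dec P) → ⟦ d ⟧ ≡ + 1
⟦⟧-yes _ (yes _) = refl
⟦⟧-yes p (no ¬p) = ⊥-elim (¬p p)

⟦⟧-no : ∀ {p} {P : Set p} → ¬ P → (d : Dec P) → ⟦ d ⟧ ≡ + 0
⟦⟧-no ¬p (yes p) = ⊥-elim (¬p p)
⟦⟧-no _  (no _)  = refl

⟦⟧-⇔ : ∀ {p q} {P : Set p} {Q : Set q} → (P → Q) → (Q → P) → (d : Dec P) (e : Dec Q) → ⟦ d ⟧ ≡ ⟦ e ⟧
⟦⟧-⇔ to _    (yes p) e = sym (⟦⟧-yes (to p) e)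
⟦⟧-⇔ _  from (no ¬p) e = sym (⟦⟧-no (¬p ∘ from) e)

⟦⟧-*-cong : ∀ {p} {P : Set p} {x y : ℤ} (d : Dec P) → (P → x ≡ y) → ⟦ d ⟧ * x ≡ ⟦ d ⟧ * y
⟦⟧-*-cong (yes p) eq = cong (_*_ (+ 1)) (eq p)
⟦⟧-*-cong (no  _) _  = refl

⟦∣?⟧-shift : ∀ m n → ⟦ m ∣? m ℕ.+ n ⟧ ≡ ⟦ m ∣? n ⟧
⟦∣?⟧-shift m n = ⟦⟧-⇔ (λ m∣m+n → ∣m+n∣m⇒∣n m∣m+n ∣-refl) (∣m∣n⇒∣m+n ∣-refl) (m ∣? m ℕ.+ n) (m ∣? n)

⟦∣?⟧-> : ∀ {m n} .{{_ : NonZero n}} → n < m → ⟦ m ∣? n ⟧ ≡ + 0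
⟦∣?⟧-> {m} {n} n<m = ⟦⟧-no (λ m∣n → ℕ.<⇒≱ n<m (∣⇒≤ m∣n)) (m ∣? n)

if-does≡⟦⟧ : ∀ {p} {P : Set p} (d : Dec P) (x : ℤ) → (if does d then x else + 0) ≡ ⟦ d ⟧ * x
if-does≡⟦⟧ (yes _) x = sym (ℤ.*-identityˡ x)
if-does≡⟦⟧ (no  _) x = refl

T-does⇒ : ∀ {p} {P : Set p} (d : Dec P) → T (does d) → P
T-does⇒ (yes p) _ = p

T-does⇐ : ∀ {p} {P : Set p} (d : Dec P) → P → T (does d)
T-does⇐ (yes _) _ = _
T-does⇐ (no ¬p) p = ¬p p

T-⇔⇒≡ : ∀ {a b : Bool} → (T a → T b) → (T b → T a) → a ≡ b
T-⇔⇒≡ {true}  {true}  _  _  = refl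
T-⇔⇒≡ {true}  {false} to _  = ⊥-elim (to _)
T-⇔⇒≡ {false} {true}  _ from = ⊥-elim (from _)
T-⇔⇒≡ {false} {false} _  _  = refl

pos-length-filter : ∀ {P : ℕ → Set} (P? : ∀ x → Dec (P x)) (g : ℕ → ℕ) k →
                    + length (filter P? (applyUpTo g k)) ≡ ∑[ j < k ] ⟦ P? (g j) ⟧
pos-length-filter P? g zero = refl
pos-length-filter P? g (suc k) with P? (g 0)
... | yes _ = trans (ℤ.pos-+ 1 _) (cong (_+_ (+ 1)) (pos-length-filter P? (g ∘ suc) k))
... | no  _ = trans (pos-length-filter P? (g ∘ suc) k) (sym (ℤ.+-identityˡ _))

-- Formal power series

infixl 7 _⋆_
infixl 6 _⊕_
infixr 8 _·_

_⊕_ : (ℕ → ℤ) → (ℕ → ℤ) → ℕ → ℤ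
(F ⊕ G) n = F n + G n

_·_ : ℤ → (ℕ → ℤ) → ℕ → ℤ
(c · F) n = c * F n

_⋆_ : (ℕ → ℤ) → (ℕ → ℤ) → ℕ → ℤ
(F ⋆ G) n = ∑[ j < suc n ] (F j * G (n ∸ j))

⋆-congˡ : ∀ {F F′} G → F ≗ F′ → F ⋆ G ≗ F′ ⋆ G
⋆-congˡ G F≗F′ n = ∑-cong (suc n) (λ j → cong (_* G (n ∸ j)) (F≗F′ j))

⋆-congʳ : ∀ F {G G′} → G ≗ G′ → F ⋆ G ≗ F ⋆ G′
⋆-congʳ F G≗G′ n = ∑-cong (suc n) (λ j → cong (F j *_) (G≗G′ (n ∸ j)))

⋆-comm : ∀ F G → F ⋆ G ≗ G ⋆ F
⋆-comm F G n = trans (∑-reverse (suc n) (λ j → F j * G (n ∸ j))) (∑-cong< (suc n) swap)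
  where
  swap : ∀ j → j < suc n → F (n ∸ j) * G (n ∸ (n ∸ j)) ≡ G j * F (n ∸ j)
  swap j j<1+n = trans (cong (λ k → F (n ∸ j) * G k) (ℕ.m∸[m∸n]≡n (ℕ.≤-pred j<1+n))) (ℤ.*-comm (F (n ∸ j)) (G j))

⋆-distribʳ-⊕ : ∀ F F′ G → (F ⊕ F′) ⋆ G ≗ F ⋆ G ⊕ F′ ⋆ G
⋆-distribʳ-⊕ F F′ G n = trans (∑-cong (suc n) (λ j → ℤ.*-distribʳ-+ (G (n ∸ j)) (F j) (F′ j)))
                               (∑-distrib-+ (suc n) (λ j → F j * G (n ∸ j)) (λ j → F′ j * G (n ∸ j)))

⋆-distribˡ-⊕ : ∀ F G G′ → F ⋆ (G ⊕ G′) ≗ F ⋆ G ⊕ F ⋆ G′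
⋆-distribˡ-⊕ F G G′ n = begin
  (F ⋆ (G ⊕ G′)) n          ≡⟨ ⋆-comm F (G ⊕ G′) n ⟩
  ((G ⊕ G′) ⋆ F) n          ≡⟨ ⋆-distribʳ-⊕ G G′ F n ⟩
  (G ⋆ F) n + (G′ ⋆ F) n    ≡⟨ cong₂ _+_ (⋆-comm G F n) (⋆-comm G′ F n) ⟩
  (F ⋆ G) n + (F ⋆ G′) n    ∎

·-⋆-assoc : ∀ c F G → (c · F) ⋆ G ≗ c · (F ⋆ G)
·-⋆-assoc c F G n = trans (∑-cong (suc n) (λ j → ℤ.*-assoc c (F j) (G (n ∸ j))))
                          (sym (*-distribˡ-∑ (suc n) c (λ j → F j * G (n ∸ j))))

⋆-·-comm : ∀ c F G → F ⋆ (c · G) ≗ c · (F ⋆ G)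
⋆-·-comm c F G n = begin
  (F ⋆ (c · G)) n   ≡⟨ ⋆-comm F (c · G) n ⟩
  ((c · G) ⋆ F) n   ≡⟨ ·-⋆-assoc c G F n ⟩
  c * (G ⋆ F) n     ≡⟨ cong (c *_) (⋆-comm G F n) ⟩
  c * (F ⋆ G) n     ∎

⋆-assoc : ∀ F G H → (F ⋆ G) ⋆ H ≗ F ⋆ (G ⋆ H)
⋆-assoc F G H zero    = assoc₀ (F 0) (G 0) (H 0)
  where
  assoc₀ : ∀ a b c → (a * b + + 0) * c + + 0 ≡ a * (b * c + + 0) + + 0
  assoc₀ = solve-∀
-- (F ⋆ G) (suc j) unfolds to F 0 * G (suc j) + ((F ∘ suc) ⋆ G) j, which lets the induction peel off F 0.
⋆-assoc F G H (suc n) = begin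
  (F ⋆ G) 0 * H (suc n) + ((F 0 · (G ∘ suc) ⊕ (F ∘ suc) ⋆ G) ⋆ H) n
    ≡⟨ cong (_+_ ((F ⋆ G) 0 * H (suc n))) (⋆-distribʳ-⊕ (F 0 · (G ∘ suc)) ((F ∘ suc) ⋆ G) H n) ⟩
  (F ⋆ G) 0 * H (suc n) + (((F 0 · (G ∘ suc)) ⋆ H) n + ((F ∘ suc) ⋆ G ⋆ H) n)
    ≡⟨ cong (_+_ ((F ⋆ G) 0 * H (suc n))) (cong₂ _+_ (·-⋆-assoc (F 0) (G ∘ suc) H n) (⋆-assoc (F ∘ suc) G H n)) ⟩
  (F 0 * G 0 + + 0) * H (suc n) + (F 0 * ((G ∘ suc) ⋆ H) n + ((F ∘ suc) ⋆ (G ⋆ H)) n)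
    ≡⟨ regroup (F 0) (G 0) (H (suc n)) _ _ ⟩
  (F ⋆ (G ⋆ H)) (suc n)  ∎
  where
  regroup : ∀ a b h x y → (a * b + + 0) * h + (a * x + y) ≡ a * (b * h + x) + y
  regroup = solve-∀

⋆-cancelˡ : ∀ U {F G} → U 0 ≡ + 1 → U ⋆ F ≗ U ⋆ G → F ≗ G
⋆-cancelˡ U {F} {G} U₀≡1 eq n = below n n ℕ.≤-refl
  where
  lead : ∀ m → (∀ j → j < m → F (m ∸ suc j) ≡ G (m ∸ suc j)) → F m ≡ G m
  lead m lower = begin
    F m       ≡⟨ sym (ℤ.*-identityˡ (F m)) ⟩
    + 1 * F m ≡⟨ cong (_* F m) (sym U₀≡1) ⟩
    U 0 * F m ≡⟨ +-cancelʳ _ _ _ (trans (eq m) (cong (_+_ (U 0 * G m)) (sym rest))) ⟩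
    U 0 * G m ≡⟨ cong (_* G m) U₀≡1 ⟩
    + 1 * G m ≡⟨ ℤ.*-identityˡ (G m) ⟩
    G m       ∎
    where
    rest : ∑[ j < m ] (U (suc j) * F (m ∸ suc j)) ≡ ∑[ j < m ] (U (suc j) * G (m ∸ suc j))
    rest = ∑-cong< m (λ j j<m → cong (U (suc j) *_) (lower j j<m))
  below : ∀ n m → m ≤ n → F m ≡ G m
  below _       zero    _   = lead 0 (λ _ ())
  below (suc n) (suc m) m≤n = lead (suc m) (λ j _ → below n (m ∸ j) (ℕ.≤-trans (ℕ.m∸n≤m m j) (ℕ.≤-pred m≤n)))

≗-below-above : ∀ i {F G : ℕ → ℤ} → (∀ n → n < i → F n ≡ G n) → (∀ n → F (i ℕ.+ n) ≡ G (i ℕ.+ n)) →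
                F ≗ G
≗-below-above i {F} {G} below above n with n ℕ.<? i
... | yes n<i = below n n<i
... | no  n≮i = subst (λ k → F k ≡ G k) (ℕ.m+[n∸m]≡n (ℕ.≮⇒≥ n≮i)) (above (n ∸ i))

monomial : ℕ → ℕ → ℤ
monomial k n = ⟦ n ℕ.≟ k ⟧

monomial-⋆ : ∀ k F {n} → k ≤ n → (monomial k ⋆ F) n ≡ F (n ∸ k)
monomial-⋆ k F {n} k≤n = begin
  (monomial k ⋆ F) n       ≡⟨ ∑-concentrated (suc n) k (s≤s k≤n) off ⟩
  monomial k k * F (n ∸ k) ≡⟨ cong (_* F (n ∸ k)) (⟦⟧-yes refl (k ℕ.≟ k)) ⟩
  + 1 * F (n ∸ k)          ≡⟨ ℤ.*-identityˡ _ ⟩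
  F (n ∸ k)                ∎
  where
  off : ∀ j → j < suc n → j ≢ k → monomial k j * F (n ∸ j) ≡ + 0
  off j _ j≢k = cong (_* F (n ∸ j)) (⟦⟧-no j≢k (j ℕ.≟ k))

monomial-⋆-< : ∀ k F {n} → n < k → (monomial k ⋆ F) n ≡ + 0
monomial-⋆-< k F {n} n<k = ∑-≡0 (suc n) (λ j j≤n → cong (_* F (n ∸ j)) (⟦⟧-no (j≢k j≤n) (j ℕ.≟ k)))
  where
  j≢k : ∀ {j} → j < suc n → j ≢ k
  j≢k j≤n refl = ℕ.<-irrefl refl (ℕ.<-≤-trans n<k (ℕ.≤-pred j≤n))

θ : (ℕ → ℤ) → ℕ → ℤ
θ F n = + n * F n

θ-⋆ : ∀ F G → θ (F ⋆ G) ≗ θ F ⋆ G ⊕ F ⋆ θ G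
θ-⋆ F G n = trans (*-distribˡ-∑ (suc n) (+ n) (λ j → F j * G (n ∸ j)))
           (trans (∑-cong< (suc n) leibniz)
                  (∑-distrib-+ (suc n) (λ j → θ F j * G (n ∸ j)) (λ j → F j * θ G (n ∸ j))))
  where
  split-weight : ∀ a b f g → (a + b) * (f * g) ≡ (a * f) * g + f * (b * g)
  split-weight = solve-∀
  leibniz : ∀ j → j < suc n → + n * (F j * G (n ∸ j)) ≡ θ F j * G (n ∸ j) + F j * θ G (n ∸ j)
  leibniz j j<1+n = begin
    + n * (F j * G (n ∸ j))
      ≡⟨ cong (λ k → + k * (F j * G (n ∸ j))) (sym (ℕ.m+[n∸m]≡n (ℕ.≤-pred j<1+n))) ⟩
    + (j ℕ.+ (n ∸ j)) * (F j * G (n ∸ j))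
      ≡⟨ cong (_* (F j * G (n ∸ j))) (ℤ.pos-+ j (n ∸ j)) ⟩
    (+ j + + (n ∸ j)) * (F j * G (n ∸ j))
      ≡⟨ split-weight (+ j) (+ (n ∸ j)) (F j) (G (n ∸ j)) ⟩
    θ F j * G (n ∸ j) + F j * θ G (n ∸ j) ∎

θ-⋆-logarithmic : ∀ {F G ρ σ} → θ F ≗ F ⋆ ρ → θ G ≗ G ⋆ σ → θ (F ⋆ G) ≗ (F ⋆ G) ⋆ (ρ ⊕ σ)
θ-⋆-logarithmic {F} {G} {ρ} {σ} θF θG n = begin
  θ (F ⋆ G) n                                ≡⟨ θ-⋆ F G n ⟩
  (θ F ⋆ G) n + (F ⋆ θ G) n                  ≡⟨ cong₂ _+_ (⋆-congˡ G θF n) (⋆-congʳ F θG n) ⟩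
  ((F ⋆ ρ) ⋆ G) n + (F ⋆ (G ⋆ σ)) n          ≡⟨ cong₂ _+_ (⋆-assoc F ρ G n) (sym (⋆-assoc F G σ n)) ⟩
  (F ⋆ (ρ ⋆ G)) n + ((F ⋆ G) ⋆ σ) n          ≡⟨ cong (_+ ((F ⋆ G) ⋆ σ) n) (⋆-congʳ F (⋆-comm ρ G) n) ⟩
  (F ⋆ (G ⋆ ρ)) n + ((F ⋆ G) ⋆ σ) n          ≡⟨ cong (_+ ((F ⋆ G) ⋆ σ) n) (sym (⋆-assoc F G ρ n)) ⟩
  ((F ⋆ G) ⋆ ρ) n + ((F ⋆ G) ⋆ σ) n          ≡⟨ sym (⋆-distribˡ-⊕ (F ⋆ G) ρ σ n) ⟩
  ((F ⋆ G) ⋆ (ρ ⊕ σ)) n                      ∎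

pos-conv : ∀ f g → (λ n → + conv f g n) ≗ (+_ ∘ f) ⋆ (+_ ∘ g)
pos-conv f g n = trans (pos-sum-applyUpTo (λ j → f j ℕ.* g (n ∸ j)) (λ j → j) (suc n))
                       (∑-cong (suc n) (λ j → ℤ.pos-* (f j) (g (n ∸ j))))

sgn-+ : ∀ a b → sgn (a ℕ.+ b) ≡ sgn a * sgn b
sgn-+ zero    b = sym (ℤ.*-identityˡ (sgn b))
sgn-+ (suc a) b = trans (cong -_ (sgn-+ a b)) (ℤ.neg-distribˡ-* (sgn a) (sgn b))

sgn*sgn≡1 : ∀ a → sgn a * sgn a ≡ + 1
sgn*sgn≡1 zero    = refl
sgn*sgn≡1 (suc a) = trans (neg*neg (sgn a)) (sgn*sgn≡1 a)
  where
  neg*neg : ∀ x → (- x) * (- x) ≡ x * x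
  neg*neg = solve-∀

sgn-parity : ∀ n → sgn n ≡ (if isEven n then + 1 else -1ℤ)
sgn-parity zero = refl
sgn-parity (suc n) with isEven n | sgn-parity n
... | true  | eq = cong -_ eq
... | false | eq = cong -_ eq

C-absorption : ∀ n k → suc k ℕ.* (suc n C suc k) ≡ suc n ℕ.* (n C k)
C-absorption n       zero    = trans (ℕ.+-identityʳ _) (trans (nC1≡n (suc n)) (sym (ℕ.*-identityʳ (suc n))))
C-absorption zero    (suc k) = trans (cong (suc (suc k) ℕ.*_) (k>n⇒nCk≡0 (s≤s (s≤s (z≤n {k})))))
                                     (trans (ℕ.*-zeroʳ (suc (suc k))) (sym (ℕ.+-identityʳ _)))
C-absorption (suc n) (suc k) = begin
  suc (suc k) ℕ.* (suc (suc n) C suc (suc k))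
    ≡⟨ cong (suc (suc k) ℕ.*_) (sym (pascal (suc n) (suc k))) ⟩
  suc (suc k) ℕ.* (A ℕ.+ B)
    ≡⟨ expand k A B ⟩
  A ℕ.+ suc k ℕ.* A ℕ.+ suc (suc k) ℕ.* B
    ≡⟨ cong₂ (λ x y → A ℕ.+ x ℕ.+ y) (C-absorption n k) (C-absorption n (suc k)) ⟩
  A ℕ.+ suc n ℕ.* (n C k) ℕ.+ suc n ℕ.* (n C suc k)
    ≡⟨ ℕ.+-assoc A _ _ ⟩
  A ℕ.+ (suc n ℕ.* (n C k) ℕ.+ suc n ℕ.* (n C suc k))
    ≡⟨ cong (A ℕ.+_) (sym (ℕ.*-distribˡ-+ (suc n) (n C k) (n C suc k))) ⟩
  A ℕ.+ suc n ℕ.* (n C k ℕ.+ n C suc k)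
    ≡⟨ cong (λ x → A ℕ.+ suc n ℕ.* x) (pascal n k) ⟩
  suc (suc n) ℕ.* A ∎
  where
  pascal : ∀ n k → n C k ℕ.+ n C suc k ≡ suc n C suc k
  pascal = nCk+nC[k+1]≡[n+1]C[k+1]
  A B : ℕ
  A = suc n C suc k
  B = suc n C suc (suc k)
  expand : ∀ k a b → suc (suc k) ℕ.* (a ℕ.+ b) ≡ a ℕ.+ suc k ℕ.* a ℕ.+ suc (suc k) ℕ.* b
  expand = ℕ-Solver.solve-∀

dimSym-recurrence : ∀ m a → suc a ℕ.* dimSym m (suc a) ≡ (m ℕ.+ a) ℕ.* dimSym m a
dimSym-recurrence m a rewrite ℕ.+-suc m a with m ℕ.+ a
... | zero  = ℕ.*-zeroʳ (suc a)
... | suc n = C-absorption n a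

dimΛ-recurrence : ∀ m a → suc a ℕ.* dimΛ m (suc a) ℕ.+ a ℕ.* dimΛ m a ≡ m ℕ.* dimΛ m a
dimΛ-recurrence zero     zero     = refl
dimΛ-recurrence zero     (suc a)  = cong₂ ℕ._+_ (ℕ.*-zeroʳ (suc (suc a))) (ℕ.*-zeroʳ (suc a))
dimΛ-recurrence (suc m)  zero     = trans (ℕ.+-identityʳ _) (C-absorption m 0)
dimΛ-recurrence (suc m)  (suc a)  = begin
  suc (suc a) ℕ.* (suc m C suc (suc a)) ℕ.+ suc a ℕ.* (suc m C suc a)
    ≡⟨ cong₂ ℕ._+_ (C-absorption m (suc a)) (C-absorption m a) ⟩
  suc m ℕ.* (m C suc a) ℕ.+ suc m ℕ.* (m C a)
    ≡⟨ sym (ℕ.*-distribˡ-+ (suc m) (m C suc a) (m C a)) ⟩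
  suc m ℕ.* (m C suc a ℕ.+ m C a)
    ≡⟨ cong (suc m ℕ.*_) (trans (ℕ.+-comm _ (m C a)) (nCk+nC[k+1]≡[n+1]C[k+1] m a)) ⟩
  suc m ℕ.* (suc m C suc a) ∎

-- One factor of the Poincaré series

dimFree : ℕ → ℕ → ℕ → ℕ
dimFree i m a = if isEven i then dimSym m a else dimΛ m a

dimFree-zero : ∀ i m → dimFree i m 0 ≡ 1
dimFree-zero i m with isEven i
... | true  = refl
... | false = refl

dimFree-recurrence : ∀ i m a → + suc a * + dimFree i m (suc a) ≡ (+ m + sgn i * + a) * + dimFree i m a
dimFree-recurrence i m a rewrite sgn-parity i with isEven i
... | true  = begin
  + suc a * + dimSym m (suc a)        ≡⟨ sym (ℤ.pos-* (suc a) _) ⟩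
  + (suc a ℕ.* dimSym m (suc a))      ≡⟨ cong +_ (dimSym-recurrence m a) ⟩
  + ((m ℕ.+ a) ℕ.* dimSym m a)        ≡⟨ ℤ.pos-* (m ℕ.+ a) _ ⟩
  + (m ℕ.+ a) * + dimSym m a          ≡⟨ cong (_* + dimSym m a) (ℤ.pos-+ m a) ⟩
  (+ m + + a) * + dimSym m a          ≡⟨ cong (λ x → (+ m + x) * + dimSym m a) (sym (ℤ.*-identityˡ (+ a))) ⟩
  (+ m + + 1 * + a) * + dimSym m a    ∎
... | false = move (+ suc a * + dimΛ m (suc a)) (+ a) (+ m) (+ dimΛ m a) (begin
  + suc a * + dimΛ m (suc a) + + a * + dimΛ m a           ≡⟨ sym (cong₂ _+_ (ℤ.pos-* (suc a) _) (ℤ.pos-* a _)) ⟩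
  + (suc a ℕ.* dimΛ m (suc a)) + + (a ℕ.* dimΛ m a)       ≡⟨ sym (ℤ.pos-+ (suc a ℕ.* dimΛ m (suc a)) _) ⟩
  + (suc a ℕ.* dimΛ m (suc a) ℕ.+ a ℕ.* dimΛ m a)         ≡⟨ cong +_ (dimΛ-recurrence m a) ⟩
  + (m ℕ.* dimΛ m a)                                      ≡⟨ ℤ.pos-* m _ ⟩
  + m * + dimΛ m a                                        ∎)
  where
  move : ∀ p q r x → p + q * x ≡ r * x → p ≡ (r + -1ℤ * q) * x
  move p q r x eq = begin
    p                         ≡⟨ sym (cancel p (q * x)) ⟩
    p + q * x + -1ℤ * (q * x) ≡⟨ cong (λ y → y + -1ℤ * (q * x)) eq ⟩
    r * x + -1ℤ * (q * x)     ≡⟨ expand r q x ⟩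
    (r + -1ℤ * q) * x         ∎
    where
    cancel : ∀ y z → y + z + -1ℤ * z ≡ y
    cancel = solve-∀
    expand : ∀ r q x → r * x + -1ℤ * (q * x) ≡ (r + -1ℤ * q) * x
    expand = solve-∀

factorSeries-multiple : ∀ m j a → factorSeries m j (a ℕ.* suc j) ≡ dimFree (suc j) m a
factorSeries-multiple m j a =
  cong₂ (λ r q → if r ℕ.≡ᵇ 0 then dimFree (suc j) m q else 0) (m*n%n≡0 a (suc j)) (m*n/n≡m a (suc j))

factorSeries-nonmultiple : ∀ m j n → ¬ suc j ∣ n → factorSeries m j n ≡ 0
factorSeries-nonmultiple m j n ∤n with n % suc j ℕ.≡ᵇ 0 in eq
... | true  = ⊥-elim (∤n (m%n≡0⇒n∣m n (suc j) (ℕ.≡ᵇ⇒≡ _ 0 (subst T (sym eq) _))))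
... | false = refl

factor : ℕ → ℕ → ℕ → ℤ
factor m j n = + factorSeries m j n

-- With i = suc j and ε = (−1)ⁱ the factor is (1 − ε tⁱ)^(−ε m); its logarithmic derivative
-- i m tⁱ / (1 − ε tⁱ) has coefficient (−1)^(e+i) i m at every positive multiple e of i.
factorDlog : ℕ → ℕ → ℕ → ℤ
factorDlog m j zero    = + 0
factorDlog m j (suc e) = ⟦ suc j ∣? suc e ⟧ * (sgn (suc e ℕ.+ suc j) * + (suc j ℕ.* m))

module _ (m j : ℕ) where
  private
    i : ℕ
    i = suc j
    ε K : ℤ
    ε = sgn i
    K = + (i ℕ.* m)
    Φ ρ Den : ℕ → ℤ
    Φ = factor m j
    ρ = factorDlog m j
    -- Den = 1 − ε tⁱ is a unit that clears the denominator of ρ.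
    Den = monomial 0 ⊕ (- ε) · monomial i

  factor-zero : Φ 0 ≡ + 1
  factor-zero = cong +_ (trans (factorSeries-multiple m j 0) (dimFree-zero i m))

  factor-gap : ∀ n → 0 < n → n < i → Φ n ≡ + 0
  factor-gap n@(suc _) _ n<i = cong +_ (factorSeries-nonmultiple m j n (λ i∣n → ℕ.<⇒≱ n<i (∣⇒≤ i∣n)))

  factorDlog-below : ∀ n → n < i → ρ n ≡ + 0
  factorDlog-below zero       _   = refl
  factorDlog-below n@(suc _) n<i = cong (_* (sgn (n ℕ.+ i) * K)) (⟦∣?⟧-> n<i)

  private
    Den-zero : Den 0 ≡ + 1
    Den-zero = cong (_+_ (+ 1)) (ℤ.*-zeroʳ (- ε))

    monomial-⋆-above : ∀ X n → (monomial i ⋆ X) (i ℕ.+ n) ≡ X n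
    monomial-⋆-above X n = trans (monomial-⋆ i X (ℕ.m≤m+n i n)) (cong X (ℕ.m+n∸m≡n i n))

    Den⋆ : ∀ X n → (Den ⋆ X) n ≡ X n + (- ε) * (monomial i ⋆ X) n
    Den⋆ X n = trans (⋆-distribʳ-⊕ (monomial 0) ((- ε) · monomial i) X n)
                   (cong₂ _+_ (monomial-⋆ 0 X z≤n) (·-⋆-assoc (- ε) (monomial i) X n))

    Den⋆-below : ∀ X n → n < i → (Den ⋆ X) n ≡ X n
    Den⋆-below X n n<i = begin
      (Den ⋆ X) n                            ≡⟨ Den⋆ X n ⟩
      X n + (- ε) * (monomial i ⋆ X) n     ≡⟨ cong (λ y → X n + (- ε) * y) (monomial-⋆-< i X n<i) ⟩
      X n + (- ε) * + 0                    ≡⟨ cong (_+_ (X n)) (ℤ.*-zeroʳ (- ε)) ⟩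
      X n + + 0                            ≡⟨ ℤ.+-identityʳ (X n) ⟩
      X n                                  ∎

    Den⋆-above : ∀ X n → (Den ⋆ X) (i ℕ.+ n) ≡ X (i ℕ.+ n) + (- ε) * X n
    Den⋆-above X n = trans (Den⋆ X (i ℕ.+ n)) (cong (λ y → X (i ℕ.+ n) + (- ε) * y) (monomial-⋆-above X n))

    K·monomial-below : ∀ X n → n < i → K * (monomial i ⋆ X) n ≡ + 0
    K·monomial-below X n n<i = trans (cong (K *_) (monomial-⋆-< i X n<i)) (ℤ.*-zeroʳ K)

    ε*ε≡1 : ε * ε ≡ + 1
    ε*ε≡1 = sgn*sgn≡1 i

    ρ-shift : ∀ n → ρ (i ℕ.+ n) ≡ ⟦ i ∣? n ⟧ * (sgn n * K)
    ρ-shift n = cong₂ _*_ (⟦∣?⟧-shift i n) (cong (_* K) sgn-shift)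
      where
      cancel : ∀ x → (ε * x) * ε ≡ x
      cancel x = trans (regroup ε x) (trans (cong (x *_) ε*ε≡1) (ℤ.*-identityʳ x))
        where
        regroup : ∀ e x → (e * x) * e ≡ x * (e * e)
        regroup = solve-∀
      sgn-shift : sgn (i ℕ.+ n ℕ.+ i) ≡ sgn n
      sgn-shift = trans (sgn-+ (i ℕ.+ n) i) (trans (cong (_* ε) (sgn-+ i n)) (cancel (sgn n)))

    Den⋆ρ : Den ⋆ ρ ≗ K · monomial i
    Den⋆ρ = ≗-below-above i below above
      where
      below : ∀ n → n < i → (Den ⋆ ρ) n ≡ K * monomial i n
      below n n<i = begin
        (Den ⋆ ρ) n       ≡⟨ Den⋆-below ρ n n<i ⟩
        ρ n               ≡⟨ factorDlog-below n n<i ⟩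
        + 0               ≡⟨ sym (ℤ.*-zeroʳ K) ⟩
        K * + 0           ≡⟨ cong (K *_) (sym (⟦⟧-no (λ n≡i → ℕ.<-irrefl n≡i n<i) (n ℕ.≟ i))) ⟩
        K * monomial i n  ∎
      vanish : ∀ a g → a * (g * K) + (- ε) * (a * ((g * ε) * K)) ≡ + 0
      vanish a g = trans (collect a g K ε) (trans (cong (λ e → a * g * K * (+ 1 - e)) ε*ε≡1) (ℤ.*-zeroʳ (a * g * K)))
        where
        collect : ∀ a g K e → a * (g * K) + (- e) * (a * ((g * e) * K)) ≡ a * g * K * (+ 1 - e * e)
        collect = solve-∀
      above : ∀ n → (Den ⋆ ρ) (i ℕ.+ n) ≡ K * monomial i (i ℕ.+ n)
      above zero = begin
        (Den ⋆ ρ) (i ℕ.+ 0)                   ≡⟨ Den⋆-above ρ 0 ⟩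
        ρ (i ℕ.+ 0) + (- ε) * + 0             ≡⟨ cong₂ _+_ (ρ-shift 0) (ℤ.*-zeroʳ (- ε)) ⟩
        ⟦ i ∣? 0 ⟧ * (+ 1 * K) + + 0          ≡⟨ cong (λ d → d * (+ 1 * K) + + 0) (⟦⟧-yes (i ∣0) (i ∣? 0)) ⟩
        + 1 * (+ 1 * K) + + 0                 ≡⟨ simplify K ⟩
        K * + 1                               ≡⟨ cong (K *_) (sym (⟦⟧-yes (ℕ.+-identityʳ i) (i ℕ.+ 0 ℕ.≟ i))) ⟩
        K * monomial i (i ℕ.+ 0)              ∎
        where
        simplify : ∀ K → + 1 * (+ 1 * K) + + 0 ≡ K * + 1
        simplify = solve-∀
      above n@(suc e) = begin
        (Den ⋆ ρ) (i ℕ.+ n)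
          ≡⟨ Den⋆-above ρ n ⟩
        ρ (i ℕ.+ n) + (- ε) * ρ n
          ≡⟨ cong (_+ (- ε) * ρ n) (ρ-shift n) ⟩
        ⟦ i ∣? n ⟧ * (sgn n * K) + (- ε) * (⟦ i ∣? n ⟧ * (sgn (n ℕ.+ i) * K))
          ≡⟨ cong (λ s → ⟦ i ∣? n ⟧ * (sgn n * K) + (- ε) * (⟦ i ∣? n ⟧ * (s * K))) (sgn-+ n i) ⟩
        ⟦ i ∣? n ⟧ * (sgn n * K) + (- ε) * (⟦ i ∣? n ⟧ * ((sgn n * ε) * K))
          ≡⟨ vanish ⟦ i ∣? n ⟧ (sgn n) ⟩
        + 0
          ≡⟨ sym (ℤ.*-zeroʳ K) ⟩
        K * + 0
          ≡⟨ cong (K *_) (sym (⟦⟧-no (ℕ.m+1+n≢m i) (i ℕ.+ n ℕ.≟ i))) ⟩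
        K * monomial i (i ℕ.+ n) ∎

    θΦ-below : ∀ n → n < i → θ Φ n ≡ + 0
    θΦ-below zero       _   = ℤ.*-zeroˡ (Φ 0)
    θΦ-below n@(suc _) n<i = trans (cong (+ n *_) (factor-gap n (s≤s z≤n) n<i)) (ℤ.*-zeroʳ (+ n))

    θΦ-step : ∀ a → + (i ℕ.+ a ℕ.* i) * Φ (suc a ℕ.* i) + (- ε) * (+ (a ℕ.* i) * Φ (a ℕ.* i)) ≡ K * Φ (a ℕ.* i)
    θΦ-step a = begin
      + (i ℕ.+ a ℕ.* i) * Φ (suc a ℕ.* i) + (- ε) * (+ (a ℕ.* i) * Φ (a ℕ.* i))
        ≡⟨ cong₂ (λ x y → + (i ℕ.+ a ℕ.* i) * x + (- ε) * (+ (a ℕ.* i) * y)) (Φ-multiple (suc a)) (Φ-multiple a) ⟩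
      + (i ℕ.+ a ℕ.* i) * + c₁ + (- ε) * (+ (a ℕ.* i) * + c₀)
        ≡⟨ cong₂ (λ x y → x * + c₁ + (- ε) * (y * + c₀)) (trans (ℤ.pos-+ i (a ℕ.* i)) (cong (_+_ (+ i)) (ℤ.pos-* a i)))
                                                         (ℤ.pos-* a i) ⟩
      (+ i + + a * + i) * + c₁ + (- ε) * ((+ a * + i) * + c₀)
        ≡⟨ pull (+ i) (+ a) ε (+ c₀) (+ c₁) ⟩
      + i * (+ suc a * + c₁) + (- ε) * (+ a * + i * + c₀)
        ≡⟨ cong (λ x → + i * x + (- ε) * (+ a * + i * + c₀)) (dimFree-recurrence i m a) ⟩
      + i * ((+ m + ε * + a) * + c₀) + (- ε) * (+ a * + i * + c₀)
        ≡⟨ cancel (+ i) (+ a) ε (+ m) (+ c₀) ⟩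
      (+ i * + m) * + c₀
        ≡⟨ cong₂ _*_ (sym (ℤ.pos-* i m)) (sym (Φ-multiple a)) ⟩
      K * Φ (a ℕ.* i) ∎
      where
      c₀ c₁ : ℕ
      c₀ = dimFree i m a
      c₁ = dimFree i m (suc a)
      Φ-multiple : ∀ b → Φ (b ℕ.* i) ≡ + dimFree i m b
      Φ-multiple b = cong +_ (factorSeries-multiple m j b)
      pull : ∀ I A e x y → (I + A * I) * y + (- e) * ((A * I) * x) ≡ I * ((+ 1 + A) * y) + (- e) * (A * I * x)
      pull = solve-∀
      cancel : ∀ I A e M x → I * ((M + e * A) * x) + (- e) * (A * I * x) ≡ (I * M) * x
      cancel = solve-∀

    Den⋆θΦ : Den ⋆ θ Φ ≗ K · (monomial i ⋆ Φ)
    Den⋆θΦ = ≗-below-above i below above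
      where
      below : ∀ n → n < i → (Den ⋆ θ Φ) n ≡ K * (monomial i ⋆ Φ) n
      below n n<i = trans (Den⋆-below (θ Φ) n n<i) (trans (θΦ-below n n<i) (sym (K·monomial-below Φ n n<i)))
      vanish : ∀ x y z k → x * + 0 + y * (z * + 0) ≡ k * + 0
      vanish = solve-∀
      above : ∀ n → (Den ⋆ θ Φ) (i ℕ.+ n) ≡ K * (monomial i ⋆ Φ) (i ℕ.+ n)
      above n with i ∣? n
      ... | yes (divides a refl) = trans (Den⋆-above (θ Φ) n) (trans (θΦ-step a) (cong (K *_) (sym (monomial-⋆-above Φ n))))
      ... | no  i∤n = begin
        (Den ⋆ θ Φ) (i ℕ.+ n)
          ≡⟨ Den⋆-above (θ Φ) n ⟩
        + (i ℕ.+ n) * Φ (i ℕ.+ n) + (- ε) * (+ n * Φ n)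
          ≡⟨ cong₂ (λ x y → + (i ℕ.+ n) * x + (- ε) * (+ n * y)) (Φ-gap (i ℕ.+ n) i∤i+n) (Φ-gap n i∤n) ⟩
        + (i ℕ.+ n) * + 0 + (- ε) * (+ n * + 0)
          ≡⟨ vanish (+ (i ℕ.+ n)) (- ε) (+ n) K ⟩
        K * + 0
          ≡⟨ cong (K *_) (sym (trans (monomial-⋆-above Φ n) (Φ-gap n i∤n))) ⟩
        K * (monomial i ⋆ Φ) (i ℕ.+ n) ∎
        where
        Φ-gap : ∀ k → ¬ i ∣ k → Φ k ≡ + 0
        Φ-gap k i∤k = cong +_ (factorSeries-nonmultiple m j k i∤k)
        i∤i+n : ¬ i ∣ i ℕ.+ n
        i∤i+n i∣i+n = i∤n (∣m+n∣m⇒∣n i∣i+n ∣-refl)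

  factor-logarithmic : θ Φ ≗ Φ ⋆ ρ
  factor-logarithmic = ⋆-cancelˡ Den Den-zero λ n → begin
    (Den ⋆ θ Φ) n            ≡⟨ Den⋆θΦ n ⟩
    K * (monomial i ⋆ Φ) n   ≡⟨ cong (K *_) (⋆-comm (monomial i) Φ n) ⟩
    K * (Φ ⋆ monomial i) n   ≡⟨ sym (⋆-·-comm K Φ (monomial i) n) ⟩
    (Φ ⋆ K · monomial i) n   ≡⟨ sym (⋆-congʳ Φ Den⋆ρ n) ⟩
    (Φ ⋆ (Den ⋆ ρ)) n        ≡⟨ sym (⋆-assoc Φ Den ρ n) ⟩
    (Φ ⋆ Den ⋆ ρ) n          ≡⟨ ⋆-congˡ ρ (⋆-comm Φ Den) n ⟩
    (Den ⋆ Φ ⋆ ρ) n          ≡⟨ ⋆-assoc Den Φ ρ n ⟩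
    (Den ⋆ (Φ ⋆ ρ)) n        ∎

-- The Poincaré series and Newton's identities

module _ (v : ℕ → ℕ) where
  private
    P : ℕ → ℕ → ℤ
    P r n = + partialS v r n
    Φ ρ : ℕ → ℕ → ℤ
    Φ r = factor (v (suc r)) r
    ρ r = factorDlog (v (suc r)) r

  partialDlog : ℕ → ℕ → ℤ
  partialDlog r e = ∑[ k < r ] ρ k e

  private
    partial-suc : ∀ r → P (suc r) ≗ P r ⋆ Φ r
    partial-suc r = pos-conv (partialS v r) (factorSeries (v (suc r)) r)

  partial-logarithmic : ∀ r → θ (P r) ≗ P r ⋆ partialDlog r
  partial-logarithmic zero    zero    = refl
  partial-logarithmic zero    (suc n) = trans (ℤ.*-zeroʳ (+ suc n)) (sym (∑-≡0 (suc (suc n)) (λ j _ → ℤ.*-zeroʳ (P 0 j))))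
  partial-logarithmic (suc r) n = begin
    θ (P (suc r)) n                           ≡⟨ cong (+ n *_) (partial-suc r n) ⟩
    θ (P r ⋆ Φ r) n                           ≡⟨ θ-⋆-logarithmic (partial-logarithmic r) (factor-logarithmic (v (suc r)) r) n ⟩
    (P r ⋆ Φ r ⋆ (partialDlog r ⊕ ρ r)) n      ≡⟨ ⋆-congˡ (partialDlog r ⊕ ρ r) (λ k → sym (partial-suc r k)) n ⟩
    (P (suc r) ⋆ (partialDlog r ⊕ ρ r)) n      ≡⟨ ⋆-congʳ (P (suc r)) (λ e → sym (∑-init-last r (λ k → ρ k e))) n ⟩
    (P (suc r) ⋆ partialDlog (suc r)) n        ∎

  partial-zero : ∀ r → P r 0 ≡ + 1
  partial-zero zero    = refl
  partial-zero (suc r) = begin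
    P (suc r) 0             ≡⟨ partial-suc r 0 ⟩
    P r 0 * Φ r 0 + + 0     ≡⟨ cong₂ (λ x y → x * y + + 0) (partial-zero r) (factor-zero (v (suc r)) r) ⟩
    + 1                     ∎

  partial-stable : ∀ r n → n ≤ r → P (suc r) n ≡ P r n
  partial-stable r n n≤r = begin
    P (suc r) n                ≡⟨ partial-suc r n ⟩
    (P r ⋆ Φ r) n              ≡⟨ ∑-concentrated (suc n) n (ℕ.n<1+n n) gap ⟩
    P r n * Φ r (n ∸ n)        ≡⟨ cong (λ k → P r n * Φ r k) (ℕ.n∸n≡0 n) ⟩
    P r n * Φ r 0              ≡⟨ cong (P r n *_) (factor-zero (v (suc r)) r) ⟩
    P r n * + 1                ≡⟨ ℤ.*-identityʳ (P r n) ⟩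
    P r n                      ∎
    where
    gap : ∀ k → k < suc n → k ≢ n → P r k * Φ r (n ∸ k) ≡ + 0
    gap k k≤n k≢n = trans (cong (P r k *_) (factor-gap (v (suc r)) r (n ∸ k) (ℕ.m<n⇒0<n∸m k<n) (s≤s n∸k≤r)))
                          (ℤ.*-zeroʳ (P r k))
      where
      k<n : k < n
      k<n = ℕ.≤∧≢⇒< (ℕ.≤-pred k≤n) k≢n
      n∸k≤r : n ∸ k ≤ r
      n∸k≤r = ℕ.≤-trans (ℕ.m∸n≤m n k) n≤r

  partial-dimS : ∀ r n → n ≤ r → P r n ≡ + dimS v n
  partial-dimS r n n≤r = subst (λ r → P r n ≡ P n n) (ℕ.m∸n+n≡m n≤r) (above (r ∸ n))
    where
    above : ∀ k → P (k ℕ.+ n) n ≡ P n n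
    above zero    = refl
    above (suc k) = trans (partial-stable (k ℕ.+ n) n (ℕ.m≤n+m n k)) (above k)

  partialDlog-stable : ∀ r e → e ≤ r → partialDlog r e ≡ partialDlog e e
  partialDlog-stable r e e≤r = ∑-truncate e r e≤r (λ k e≤k _ → factorDlog-below (v (suc k)) k e (s≤s e≤k))

  dimSDlog : ℕ → ℤ
  dimSDlog e = partialDlog e e

  dimS-logarithmic : θ (+_ ∘ dimS v) ≗ (+_ ∘ dimS v) ⋆ dimSDlog
  dimS-logarithmic d = begin
    + d * + dimS v d                                          ≡⟨ partial-logarithmic d d ⟩
    (P d ⋆ partialDlog d) d                                   ≡⟨ ∑-cong< (suc d) stabilise ⟩
    ((+_ ∘ dimS v) ⋆ dimSDlog) d                              ∎
    where
    stabilise : ∀ j → j < suc d → P d j * partialDlog d (d ∸ j) ≡ + dimS v j * dimSDlog (d ∸ j)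
    stabilise j j≤d = cong₂ _*_ (partial-dimS d j (ℕ.≤-pred j≤d)) (partialDlog-stable d (d ∸ j) (ℕ.m∸n≤m d j))

module _ (S r s : ℕ → ℤ) (S-zero : S 0 ≡ + 1) (θS : θ S ≗ S ⋆ r) (s≡S : ∀ n → 1 ≤ n → s n ≡ S n) where
  private
    p : ℕ → ℤ
    p e = sgn (suc e) * r e

    pRev : ℕ → List ℤ
    pRev zero    = []
    pRev (suc d) = p (suc d) ∷ pRev d

    tailSum : ℕ → ℤ
    tailSum d = ∑[ k < d ] (S (suc k) * r (d ∸ k))

    r-zero : r 0 ≡ + 0
    r-zero = begin
      r 0           ≡⟨ sym (ℤ.*-identityˡ (r 0)) ⟩
      + 1 * r 0     ≡⟨ cong (_* r 0) (sym S-zero) ⟩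
      S 0 * r 0     ≡⟨ sym (ℤ.+-identityʳ _) ⟩
      (S ⋆ r) 0     ≡⟨ sym (θS 0) ⟩
      + 0 * S 0     ≡⟨ ℤ.*-zeroˡ (S 0) ⟩
      + 0           ∎

    newton : ∀ d → + suc d * S (suc d) ≡ r (suc d) + tailSum d
    newton d = begin
      + suc d * S (suc d)
        ≡⟨ θS (suc d) ⟩
      S 0 * r (suc d) + ∑[ k < suc d ] (S (suc k) * r (d ∸ k))
        ≡⟨ cong₂ _+_ (trans (cong (_* r (suc d)) S-zero) (ℤ.*-identityˡ _))
           (∑-init-last d (λ k → S (suc k) * r (d ∸ k))) ⟩
      r (suc d) + (tailSum d + S (suc d) * r (d ∸ d))
        ≡⟨ cong (λ e → r (suc d) + (tailSum d + S (suc d) * r e)) (ℕ.n∸n≡0 d) ⟩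
      r (suc d) + (tailSum d + S (suc d) * r 0)
        ≡⟨ cong (λ x → r (suc d) + (tailSum d + S (suc d) * x)) r-zero ⟩
      r (suc d) + (tailSum d + S (suc d) * + 0)
        ≡⟨ cong (λ x → r (suc d) + x) (trans (cong (_+_ (tailSum d)) (ℤ.*-zeroʳ (S (suc d)))) (ℤ.+-identityʳ _)) ⟩
      r (suc d) + tailSum d ∎

    newtonSum-pRev : ∀ d i → newtonSum s i (pRev d) ≡ ∑[ k < d ] (sgn (i ℕ.+ k ∸ 1) * s (i ℕ.+ k) * p (d ∸ k))
    newtonSum-pRev zero    i = refl
    newtonSum-pRev (suc d) i = cong₂ _+_
      (cong (λ x → sgn (x ∸ 1) * s x * p (suc d)) (sym (ℕ.+-identityʳ i)))
      (trans (newtonSum-pRev d (suc i)) (∑-cong d (λ k → cong (λ x → sgn (x ∸ 1) * s x * p (d ∸ k)) (sym (ℕ.+-suc i k)))))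

    newtonSum-tailSum : ∀ d → newtonSum s 1 (pRev d) ≡ (- sgn d) * tailSum d
    newtonSum-tailSum d = trans (newtonSum-pRev d 1) (trans (∑-cong< d term) (sym (*-distribˡ-∑ d (- sgn d) _)))
      where
      regroup : ∀ a b c d → a * b * (c * d) ≡ (a * c) * (b * d)
      regroup = solve-∀
      term : ∀ k → k < d → sgn k * s (suc k) * p (d ∸ k) ≡ (- sgn d) * (S (suc k) * r (d ∸ k))
      term k k<d = begin
        sgn k * s (suc k) * (sgn (suc (d ∸ k)) * r (d ∸ k))
          ≡⟨ cong (λ x → sgn k * x * p (d ∸ k)) (s≡S (suc k) (s≤s z≤n)) ⟩
        sgn k * S (suc k) * (sgn (suc (d ∸ k)) * r (d ∸ k))
          ≡⟨ regroup (sgn k) (S (suc k)) _ (r (d ∸ k)) ⟩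
        sgn k * sgn (suc (d ∸ k)) * (S (suc k) * r (d ∸ k))
          ≡⟨ cong (_* (S (suc k) * r (d ∸ k))) (sym (sgn-+ k (suc (d ∸ k)))) ⟩
        sgn (k ℕ.+ suc (d ∸ k)) * (S (suc k) * r (d ∸ k))
          ≡⟨ cong (λ e → sgn e * (S (suc k) * r (d ∸ k))) k+[1+[d-k]]≡1+d ⟩
        (- sgn d) * (S (suc k) * r (d ∸ k)) ∎
        where
        k+[1+[d-k]]≡1+d : k ℕ.+ suc (d ∸ k) ≡ suc d
        k+[1+[d-k]]≡1+d = trans (ℕ.+-suc k (d ∸ k)) (cong suc (ℕ.m+[n∸m]≡n (ℕ.<⇒≤ k<d)))

    recursion : ∀ d → newtonSum s 1 (pRev d) + sgn d * + suc d * s (suc d) ≡ p (suc d)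
    recursion d = begin
      newtonSum s 1 (pRev d) + sgn d * + suc d * s (suc d)
        ≡⟨ cong₂ (λ x y → x + sgn d * + suc d * y) (newtonSum-tailSum d) (s≡S (suc d) (s≤s z≤n)) ⟩
      (- sgn d) * tailSum d + sgn d * + suc d * S (suc d)
        ≡⟨ regroup (sgn d) (tailSum d) (+ suc d) (S (suc d)) ⟩
      (- sgn d) * tailSum d + sgn d * (+ suc d * S (suc d))
        ≡⟨ cong (λ x → (- sgn d) * tailSum d + sgn d * x) (newton d) ⟩
      (- sgn d) * tailSum d + sgn d * (r (suc d) + tailSum d)
        ≡⟨ cancel (sgn d) (tailSum d) (r (suc d)) ⟩
      (- - sgn d) * r (suc d) ∎
      where
      regroup : ∀ g t n x → (- g) * t + g * n * x ≡ (- g) * t + g * (n * x)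
      regroup = solve-∀
      cancel : ∀ g t x → (- g) * t + g * (x + t) ≡ (- - g) * x
      cancel = solve-∀

    powerSumsRev≡pRev : ∀ d → powerSumsRev s d ≡ pRev d
    powerSum-suc : ∀ d → powerSum s (suc d) ≡ p (suc d)

    powerSum-suc d = trans (cong (λ l → newtonSum s 1 l + sgn d * + suc d * s (suc d)) (powerSumsRev≡pRev d)) (recursion d)

    powerSumsRev≡pRev zero    = refl
    powerSumsRev≡pRev (suc d) = cong₂ _∷_ (powerSum-suc d) (powerSumsRev≡pRev d)

  powerSum-logarithmic : ∀ e → 1 ≤ e → powerSum s e ≡ sgn (suc e) * r e
  powerSum-logarithmic (suc d) _ = powerSum-suc d

-- Divisor sums and Möbius inversion

divisorSum : ℕ → (ℕ → ℤ) → ℤ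
divisorSum n f = ∑[ k < n ] (⟦ suc k ∣? n ⟧ * f (suc k))

divisorSum-cong : ∀ n {f g : ℕ → ℤ} → (∀ d → d ∣ n → f d ≡ g d) → divisorSum n f ≡ divisorSum n g
divisorSum-cong n eq = ∑-cong n (λ k → ⟦⟧-*-cong (suc k ∣? n) (eq (suc k)))

divisorSum-distrib-+ : ∀ n (f g : ℕ → ℤ) → divisorSum n (λ d → f d + g d) ≡ divisorSum n f + divisorSum n g
divisorSum-distrib-+ n f g = trans (∑-cong n (λ k → ℤ.*-distribˡ-+ ⟦ suc k ∣? n ⟧ (f (suc k)) (g (suc k))))
                                   (∑-distrib-+ n (λ k → ⟦ suc k ∣? n ⟧ * f (suc k)) (λ k → ⟦ suc k ∣? n ⟧ * g (suc k)))

∑-multiples : ∀ c {{_ : NonZero c}} n (H : ℕ → ℤ) →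
              ∑[ k < n ℕ.* c ] (⟦ c ∣? suc k ⟧ * H (suc k)) ≡ ∑[ e < n ] H (suc e ℕ.* c)
∑-multiples c          zero    H = refl
∑-multiples c@(suc c′) (suc n) H = begin
  ∑[ k < c ℕ.+ n ℕ.* c ] (⟦ c ∣? suc k ⟧ * H (suc k))
    ≡⟨ ∑-split c (n ℕ.* c) (λ k → ⟦ c ∣? suc k ⟧ * H (suc k)) ⟩
  ∑[ k < c ] (⟦ c ∣? suc k ⟧ * H (suc k)) + ∑[ k < n ℕ.* c ] (⟦ c ∣? suc (c ℕ.+ k) ⟧ * H (suc (c ℕ.+ k)))
    ≡⟨ cong₂ _+_ first (∑-cong (n ℕ.* c) shift) ⟩
  H (1 ℕ.* c) + ∑[ k < n ℕ.* c ] (⟦ c ∣? suc k ⟧ * H (c ℕ.+ suc k))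
    ≡⟨ cong (_+_ (H (1 ℕ.* c))) (∑-multiples c n (λ a → H (c ℕ.+ a))) ⟩
  H (1 ℕ.* c) + ∑[ e < n ] H (suc (suc e) ℕ.* c)  ∎
  where
  first : ∑[ k < c ] (⟦ c ∣? suc k ⟧ * H (suc k)) ≡ H (1 ℕ.* c)
  first = begin
    ∑[ k < c ] (⟦ c ∣? suc k ⟧ * H (suc k))  ≡⟨ ∑-concentrated c c′ ℕ.≤-refl below ⟩
    ⟦ c ∣? c ⟧ * H c                         ≡⟨ cong (_* H c) (⟦⟧-yes ∣-refl (c ∣? c)) ⟩
    + 1 * H c                                ≡⟨ ℤ.*-identityˡ (H c) ⟩
    H c                                      ≡⟨ cong H (sym (ℕ.*-identityˡ c)) ⟩
    H (1 ℕ.* c)                              ∎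
    where
    below : ∀ k → k < c → k ≢ c′ → ⟦ c ∣? suc k ⟧ * H (suc k) ≡ + 0
    below k k<c k≢c′ = cong (_* H (suc k)) (⟦∣?⟧-> (s≤s (ℕ.≤∧≢⇒< (ℕ.≤-pred k<c) k≢c′)))
  shift : ∀ k → ⟦ c ∣? suc (c ℕ.+ k) ⟧ * H (suc (c ℕ.+ k)) ≡ ⟦ c ∣? suc k ⟧ * H (c ℕ.+ suc k)
  shift k rewrite sym (ℕ.+-suc c k) = cong (_* H (c ℕ.+ suc k)) (⟦∣?⟧-shift c (suc k))

divisorSum-multiples : ∀ t c {{_ : NonZero c}} (g : ℕ → ℤ) →
                       divisorSum (t ℕ.* c) (λ d → ⟦ c ∣? d ⟧ * g d) ≡ divisorSum t (λ e → g (e ℕ.* c))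
divisorSum-multiples t c g = begin
  ∑[ k < t ℕ.* c ] (⟦ suc k ∣? t ℕ.* c ⟧ * (⟦ c ∣? suc k ⟧ * g (suc k)))
    ≡⟨ ∑-cong (t ℕ.* c) (λ k → swap ⟦ suc k ∣? t ℕ.* c ⟧ ⟦ c ∣? suc k ⟧ (g (suc k))) ⟩
  ∑[ k < t ℕ.* c ] (⟦ c ∣? suc k ⟧ * (⟦ suc k ∣? t ℕ.* c ⟧ * g (suc k)))
    ≡⟨ ∑-multiples c t (λ a → ⟦ a ∣? t ℕ.* c ⟧ * g a) ⟩
  ∑[ e < t ] (⟦ suc e ℕ.* c ∣? t ℕ.* c ⟧ * g (suc e ℕ.* c))
    ≡⟨ ∑-cong t (λ e → cong (_* g (suc e ℕ.* c)) (cancel (suc e))) ⟩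
  ∑[ e < t ] (⟦ suc e ∣? t ⟧ * g (suc e ℕ.* c)) ∎
  where
  swap : ∀ x y z → x * (y * z) ≡ y * (x * z)
  swap = solve-∀
  cancel : ∀ d → ⟦ d ℕ.* c ∣? t ℕ.* c ⟧ ≡ ⟦ d ∣? t ⟧
  cancel d = ⟦⟧-⇔ (*-cancelʳ-∣ c) (*-monoˡ-∣ c) (d ℕ.* c ∣? t ℕ.* c) (d ∣? t)

∑-cofactor : ∀ t .{{_ : NonZero t}} e (f : ℕ → ℤ) →
             ∑[ a < t ] (⟦ suc a ℕ.* suc e ℕ.≟ t ⟧ * f (suc a)) ≡ ⟦ suc e ∣? t ⟧ * f (t / suc e)
∑-cofactor t e f with suc e ∣? t
... | no e∤t = ∑-≡0 t (λ a _ → cong (_* f (suc a)) (⟦⟧-no (e∤t ∘ divides (suc a) ∘ sym) (suc a ℕ.* suc e ℕ.≟ t)))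
... | yes (divides zero    t≡0)  = ⊥-elim (ℕ.≢-nonZero⁻¹ t t≡0)
... | yes (divides (suc q) refl) = begin
  ∑[ a < t ] (⟦ suc a ℕ.* suc e ℕ.≟ t ⟧ * f (suc a))  ≡⟨ ∑-concentrated t q (ℕ.m≤m*n (suc q) (suc e)) off ⟩
  ⟦ t ℕ.≟ t ⟧ * f (suc q)                             ≡⟨ cong (_* f (suc q)) (⟦⟧-yes refl (t ℕ.≟ t)) ⟩
  + 1 * f (suc q)                                     ≡⟨ cong (λ a → + 1 * f a) (sym (m*n/n≡m (suc q) (suc e))) ⟩
  + 1 * f (t / suc e)                                 ∎
  where
  off : ∀ a → a < t → a ≢ q → ⟦ suc a ℕ.* suc e ℕ.≟ t ⟧ * f (suc a) ≡ + 0
  off a _ a≢q = cong (_* f (suc a)) (⟦⟧-no (a≢q ∘ ℕ.suc-injective ∘ ℕ.*-cancelʳ-≡ (suc a) (suc q) (suc e))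
                                             (suc a ℕ.* suc e ℕ.≟ t))

divisorSum-cofactor : ∀ t (f : ℕ → ℤ) → ∑[ k < t ] (⟦ suc k ∣? t ⟧ * f (t / suc k)) ≡ divisorSum t f
divisorSum-cofactor zero      f = refl
divisorSum-cofactor t@(suc _) f = begin
  ∑[ e < t ] (⟦ suc e ∣? t ⟧ * f (t / suc e))
    ≡⟨ ∑-cong t (λ e → sym (∑-cofactor t e f)) ⟩
  ∑[ e < t ] ∑[ a < t ] (⟦ suc a ℕ.* suc e ℕ.≟ t ⟧ * f (suc a))
    ≡⟨ ∑-comm t t (λ e a → ⟦ suc a ℕ.* suc e ℕ.≟ t ⟧ * f (suc a)) ⟩
  ∑[ a < t ] ∑[ e < t ] (⟦ suc a ℕ.* suc e ℕ.≟ t ⟧ * f (suc a))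
    ≡⟨ ∑-cong t (λ a → sym (*-distribʳ-∑ t (f (suc a)) (λ e → ⟦ suc a ℕ.* suc e ℕ.≟ t ⟧))) ⟩
  ∑[ a < t ] (∑[ e < t ] ⟦ suc a ℕ.* suc e ℕ.≟ t ⟧ * f (suc a))
    ≡⟨ ∑-cong t (λ a → cong (_* f (suc a)) (divisor-count a)) ⟩
  ∑[ a < t ] (⟦ suc a ∣? t ⟧ * f (suc a)) ∎
  where
  divisor-count : ∀ a → ∑[ e < t ] ⟦ suc a ℕ.* suc e ℕ.≟ t ⟧ ≡ ⟦ suc a ∣? t ⟧
  divisor-count a = begin
    ∑[ e < t ] ⟦ suc a ℕ.* suc e ℕ.≟ t ⟧           ≡⟨ ∑-cong t (λ e → trans (commute e) (sym (ℤ.*-identityʳ _))) ⟩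
    ∑[ e < t ] (⟦ suc e ℕ.* suc a ℕ.≟ t ⟧ * + 1)   ≡⟨ ∑-cofactor t a (λ _ → + 1) ⟩
    ⟦ suc a ∣? t ⟧ * + 1                           ≡⟨ ℤ.*-identityʳ _ ⟩
    ⟦ suc a ∣? t ⟧                                 ∎
    where
    commute : ∀ e → ⟦ suc a ℕ.* suc e ℕ.≟ t ⟧ ≡ ⟦ suc e ℕ.* suc a ℕ.≟ t ⟧
    commute e = ⟦⟧-⇔ (trans (ℕ.*-comm (suc e) (suc a))) (trans (ℕ.*-comm (suc a) (suc e)))
                     (suc a ℕ.* suc e ℕ.≟ t) (suc e ℕ.* suc a ℕ.≟ t)

hasSquareFactor-sound : ∀ n → T (hasSquareFactor n) → ∃[ k ] (2 ≤ k × k ℕ.* k ∣ n)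
hasSquareFactor-sound n sq with applyUpTo⁻ id (any⁻ (λ d → does (suc (suc d) ℕ.* suc (suc d) ∣? n)) (upTo n) sq)
... | d , _ , dd∣n = suc (suc d) , s≤s (s≤s z≤n) , T-does⇒ (suc (suc d) ℕ.* suc (suc d) ∣? n) dd∣n

hasSquareFactor-complete : ∀ n .{{_ : NonZero n}} k → 2 ≤ k → k ℕ.* k ∣ n → T (hasSquareFactor n)
hasSquareFactor-complete n (suc zero)       (s≤s ()) _
hasSquareFactor-complete n k@(suc (suc d)) _ kk∣n =
  any⁺ (λ d → does (suc (suc d) ℕ.* suc (suc d) ∣? n)) (applyUpTo⁺ id (T-does⇐ (k ℕ.* k ∣? n) kk∣n) d<n)
  where
  d<n : d < n
  d<n = ℕ.≤-trans (ℕ.≤-trans (ℕ.n≤1+n (suc d)) (ℕ.m≤m*n k k)) (∣⇒≤ kk∣n)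

prime∤⇒coprime : ∀ {p a} → Prime p → ¬ p ∣ a → Coprime a p
prime∤⇒coprime pp p∤a (d∣a , d∣p) with prime⇒irreducible pp d∣p
... | inj₁ d≡1 = d≡1
... | inj₂ refl = ⊥-elim (p∤a d∣a)

module _ {p} (pp : Prime p) where
  private instance
    p≢0 : NonZero p
    p≢0 = prime⇒nonZero pp

  private
    2≤p : 2 ≤ p
    2≤p = ℕ.nonTrivial⇒n>1 p {{prime⇒nonTrivial pp}}

  möbius-*-prime-∣ : ∀ e .{{_ : NonZero e}} → p ∣ e → möbius (e ℕ.* p) ≡ + 0
  möbius-*-prime-∣ e p∣e = cong (λ b → if b then + 0 else sgn (numPrimeDivisors (e ℕ.* p))) square
    where
    instance _ = ℕ.m*n≢0 e p
    square : hasSquareFactor (e ℕ.* p) ≡ true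
    square = Equivalence.to T-≡ (hasSquareFactor-complete (e ℕ.* p) p 2≤p (*-monoˡ-∣ p p∣e))

  hasSquareFactor-*-prime : ∀ e .{{_ : NonZero e}} → ¬ p ∣ e → hasSquareFactor (e ℕ.* p) ≡ hasSquareFactor e
  hasSquareFactor-*-prime e p∤e = T-⇔⇒≡ to from
    where
    instance
      e*p≢0 : NonZero (e ℕ.* p)
      e*p≢0 = ℕ.m*n≢0 e p
    to : T (hasSquareFactor (e ℕ.* p)) → T (hasSquareFactor e)
    to sq with hasSquareFactor-sound (e ℕ.* p) sq
    ... | k , 2≤k , kk∣ep = hasSquareFactor-complete e k 2≤k (coprime-divisor (prime∤⇒coprime pp p∤kk) kk∣pe)
      where
      kk∣pe : k ℕ.* k ∣ p ℕ.* e
      kk∣pe = subst (k ℕ.* k ∣_) (ℕ.*-comm e p) kk∣ep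
      p∤kk : ¬ p ∣ k ℕ.* k
      p∤kk p∣kk = p∤e (*-cancelʳ-∣ p (∣-trans (*-pres-∣ p∣k p∣k) kk∣ep))
        where
        p∣k : p ∣ k
        p∣k = reduce (euclidsLemma k k pp p∣kk)
    from : T (hasSquareFactor e) → T (hasSquareFactor (e ℕ.* p))
    from sq with hasSquareFactor-sound e sq
    ... | k , 2≤k , kk∣e = hasSquareFactor-complete (e ℕ.* p) k 2≤k (∣m⇒∣m*n p kk∣e)

  private
    primeDivisorOf? : ∀ n q → Dec (Prime q × q ∣ n)
    primeDivisorOf? n q = prime? q ×-dec q ∣? n

    primeDivisor-*-prime : ∀ e → ¬ p ∣ e → ∀ q →
                           ⟦ primeDivisorOf? (e ℕ.* p) q ⟧ ≡ ⟦ q ℕ.≟ p ⟧ + ⟦ primeDivisorOf? e q ⟧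
    primeDivisor-*-prime e p∤e q with q ℕ.≟ p
    ... | yes refl = trans (⟦⟧-yes (pp , n∣m*n e) (primeDivisorOf? (e ℕ.* q) q))
                           (sym (cong (_+_ (+ 1)) (⟦⟧-no (p∤e ∘ proj₂) (primeDivisorOf? e q))))
    ... | no  q≢p  = trans (⟦⟧-⇔ to from (primeDivisorOf? (e ℕ.* p) q) (primeDivisorOf? e q)) (sym (ℤ.+-identityˡ _))
      where
      q∤p : Prime q → ¬ q ∣ p
      q∤p qq q∣p with prime⇒irreducible pp q∣p
      ... | inj₁ refl = ¬prime[1] qq
      ... | inj₂ q≡p  = q≢p q≡p
      to : Prime q × q ∣ e ℕ.* p → Prime q × q ∣ e
      to (qq , q∣ep) = qq , [ id , ⊥-elim ∘ q∤p qq ] (euclidsLemma e p qq q∣ep)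
      from : Prime q × q ∣ e → Prime q × q ∣ e ℕ.* p
      from (qq , q∣e) = qq , ∣m⇒∣m*n p q∣e

  numPrimeDivisors-*-prime : ∀ e .{{_ : NonZero e}} → ¬ p ∣ e → numPrimeDivisors (e ℕ.* p) ≡ suc (numPrimeDivisors e)
  numPrimeDivisors-*-prime e p∤e = ℤ.+-injective (begin
    + numPrimeDivisors (e ℕ.* p)
      ≡⟨ pos-length-filter (primeDivisorOf? (e ℕ.* p)) id (suc (e ℕ.* p)) ⟩
    ∑[ q < suc (e ℕ.* p) ] ⟦ primeDivisorOf? (e ℕ.* p) q ⟧
      ≡⟨ ∑-cong (suc (e ℕ.* p)) (primeDivisor-*-prime e p∤e) ⟩
    ∑[ q < suc (e ℕ.* p) ] (⟦ q ℕ.≟ p ⟧ + ⟦ primeDivisorOf? e q ⟧)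
      ≡⟨ ∑-distrib-+ (suc (e ℕ.* p)) (λ q → ⟦ q ℕ.≟ p ⟧) (λ q → ⟦ primeDivisorOf? e q ⟧) ⟩
    ∑[ q < suc (e ℕ.* p) ] ⟦ q ℕ.≟ p ⟧ + ∑[ q < suc (e ℕ.* p) ] ⟦ primeDivisorOf? e q ⟧
      ≡⟨ cong₂ _+_ just-p divisors-of-e ⟩
    + 1 + ∑[ q < suc e ] ⟦ primeDivisorOf? e q ⟧
      ≡⟨ cong (_+_ (+ 1)) (sym (pos-length-filter (primeDivisorOf? e) id (suc e))) ⟩
    + 1 + + numPrimeDivisors e
      ≡⟨ sym (ℤ.pos-+ 1 (numPrimeDivisors e)) ⟩
    + suc (numPrimeDivisors e) ∎)
    where
    just-p : ∑[ q < suc (e ℕ.* p) ] ⟦ q ℕ.≟ p ⟧ ≡ + 1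
    just-p = trans (∑-concentrated (suc (e ℕ.* p)) p (s≤s (ℕ.m≤n*m p e)) (λ q _ q≢p → ⟦⟧-no q≢p (q ℕ.≟ p)))
                   (⟦⟧-yes refl (p ℕ.≟ p))
    divisors-of-e : ∑[ q < suc (e ℕ.* p) ] ⟦ primeDivisorOf? e q ⟧ ≡ ∑[ q < suc e ] ⟦ primeDivisorOf? e q ⟧
    divisors-of-e = ∑-truncate (suc e) (suc (e ℕ.* p)) (s≤s (ℕ.m≤m*n e p))
                      (λ q e<q _ → ⟦⟧-no (λ (_ , q∣e) → ℕ.<⇒≱ e<q (∣⇒≤ q∣e)) (primeDivisorOf? e q))

  möbius-*-prime-∤ : ∀ e .{{_ : NonZero e}} → ¬ p ∣ e → möbius (e ℕ.* p) ≡ - möbius e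
  möbius-*-prime-∤ e p∤e rewrite hasSquareFactor-*-prime e p∤e | numPrimeDivisors-*-prime e p∤e with hasSquareFactor e
  ... | true  = refl
  ... | false = refl

  divisorSum-möbius-*-prime : ∀ t .{{_ : NonZero t}} → divisorSum (t ℕ.* p) möbius ≡ + 0
  divisorSum-möbius-*-prime t = begin
    divisorSum (t ℕ.* p) möbius
      ≡⟨ divisorSum-cong (t ℕ.* p) (λ d _ → split d) ⟩
    divisorSum (t ℕ.* p) (λ d → ⟦ p ∣? d ⟧ * möbius d + ⟦ p∤? d ⟧ * möbius d)
      ≡⟨ divisorSum-distrib-+ (t ℕ.* p) (λ d → ⟦ p ∣? d ⟧ * möbius d) (λ d → ⟦ p∤? d ⟧ * möbius d) ⟩
    divisorSum (t ℕ.* p) (λ d → ⟦ p ∣? d ⟧ * möbius d) + divisorSum (t ℕ.* p) (λ d → ⟦ p∤? d ⟧ * möbius d)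
      ≡⟨ cong₂ _+_ multiplesOfP coprimeToP ⟩
    divisorSum t (λ e → ⟦ p∤? e ⟧ * (- möbius e)) + divisorSum t (λ e → ⟦ p∤? e ⟧ * möbius e)
      ≡⟨ sym (divisorSum-distrib-+ t (λ e → ⟦ p∤? e ⟧ * (- möbius e)) (λ e → ⟦ p∤? e ⟧ * möbius e)) ⟩
    divisorSum t (λ e → ⟦ p∤? e ⟧ * (- möbius e) + ⟦ p∤? e ⟧ * möbius e)
      ≡⟨ ∑-≡0 t (λ k _ → cancel ⟦ suc k ∣? t ⟧ ⟦ p∤? (suc k) ⟧ (möbius (suc k))) ⟩
    + 0 ∎
    where
    p∤? : ∀ d → Dec (¬ p ∣ d)
    p∤? d = ¬? (p ∣? d)
    split : ∀ d → möbius d ≡ ⟦ p ∣? d ⟧ * möbius d + ⟦ p∤? d ⟧ * möbius d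
    split d with p ∣? d
    ... | yes _ = sym (trans (ℤ.+-identityʳ _) (ℤ.*-identityˡ _))
    ... | no  _ = sym (trans (ℤ.+-identityˡ _) (ℤ.*-identityˡ _))
    cancel : ∀ a b x → a * (b * (- x) + b * x) ≡ + 0
    cancel = solve-∀
    multiplesOfP : divisorSum (t ℕ.* p) (λ d → ⟦ p ∣? d ⟧ * möbius d) ≡
                   divisorSum t (λ e → ⟦ p∤? e ⟧ * (- möbius e))
    multiplesOfP = trans (divisorSum-multiples t p möbius)
                         (∑-cong t (λ k → cong (⟦ suc k ∣? t ⟧ *_) (cases (suc k) (p ∣? suc k))))
      where
      cases : ∀ e .{{_ : NonZero e}} (p∣?e : Dec (p ∣ e)) → möbius (e ℕ.* p) ≡ ⟦ ¬? p∣?e ⟧ * (- möbius e)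
      cases e (yes p∣e) = möbius-*-prime-∣ e p∣e
      cases e (no  p∤e) = trans (möbius-*-prime-∤ e p∤e) (sym (ℤ.*-identityˡ _))
    coprimeToP : divisorSum (t ℕ.* p) (λ d → ⟦ p∤? d ⟧ * möbius d) ≡
                 divisorSum t (λ e → ⟦ p∤? e ⟧ * möbius e)
    coprimeToP = trans (∑-cong (t ℕ.* p) (λ k → drop-p (suc k) (p ∣? suc k)))
                       (∑-truncate t (t ℕ.* p) (ℕ.m≤m*n t p) (λ k t≤k _ → cong (_* _) (⟦∣?⟧-> (s≤s t≤k))))
      where
      drop-p : ∀ d (p∣?d : Dec (p ∣ d)) →
               ⟦ d ∣? t ℕ.* p ⟧ * (⟦ ¬? p∣?d ⟧ * möbius d) ≡ ⟦ d ∣? t ⟧ * (⟦ ¬? p∣?d ⟧ * möbius d)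
      drop-p d (yes _)  = trans (ℤ.*-zeroʳ ⟦ d ∣? t ℕ.* p ⟧) (sym (ℤ.*-zeroʳ ⟦ d ∣? t ⟧))
      drop-p d (no p∤d) = cong (_* (+ 1 * möbius d)) (⟦⟧-⇔ to (∣m⇒∣m*n p) (d ∣? t ℕ.* p) (d ∣? t))
        where
        to : d ∣ t ℕ.* p → d ∣ t
        to d∣tp = coprime-divisor (prime∤⇒coprime pp p∤d) (subst (d ∣_) (ℕ.*-comm t p) d∣tp)

primeDivisor : ∀ n → 2 ≤ n → ∃[ p ] (Prime p × p ∣ n)
primeDivisor (suc zero) (s≤s ())
primeDivisor n@(suc (suc _)) _ with factorise n
... | record { factors = p ∷ ps ; isFactorisation = n≡p*ps ; factorsPrime = pp ∷ _ } =
  p , pp , divides (product ps) (trans n≡p*ps (ℕ.*-comm p (product ps)))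
... | record { factors = [] ; isFactorisation = () }

divisorSum-möbius : ∀ t .{{_ : NonZero t}} → divisorSum t möbius ≡ ⟦ t ℕ.≟ 1 ⟧
divisorSum-möbius (suc zero)          = refl
divisorSum-möbius t@(suc (suc _)) with primeDivisor t (s≤s (s≤s z≤n))
... | p , pp , divides zero    ()
... | p , pp , divides q@(suc _) t≡q*p = trans (cong (λ n → divisorSum n möbius) t≡q*p) (divisorSum-möbius-*-prime pp q)

möbiusTransform : ℕ → (ℕ → ℤ) → ℤ
möbiusTransform N F = ∑[ k < N ] (⟦ suc k ∣? N ⟧ * (möbius (N / suc k) * F (suc k)))

möbius-over-multiples : ∀ N .{{_ : NonZero N}} c →
                        ∑[ k < N ] (⟦ suc k ∣? N ⟧ * (möbius (N / suc k) * ⟦ suc c ∣? suc k ⟧)) ≡ ⟦ suc c ℕ.≟ N ⟧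
möbius-over-multiples N c with suc c ∣? N
... | no c∤N = trans (∑-≡0 N (λ k _ → vanish k)) (sym (⟦⟧-no (λ c≡N → c∤N (∣-reflexive c≡N)) (suc c ℕ.≟ N)))
  where
  vanish : ∀ k → ⟦ suc k ∣? N ⟧ * (möbius (N / suc k) * ⟦ suc c ∣? suc k ⟧) ≡ + 0
  vanish k with suc k ∣? N | suc c ∣? suc k
  ... | no _    | _       = refl
  ... | yes _   | no _    = trans (ℤ.*-identityˡ _) (ℤ.*-zeroʳ (möbius (N / suc k)))
  ... | yes k∣N | yes c∣k = ⊥-elim (c∤N (∣-trans c∣k k∣N))
... | yes (divides zero    N≡0)  = ⊥-elim (ℕ.≢-nonZero⁻¹ N N≡0)
... | yes (divides t@(suc _) refl) = begin
  ∑[ k < N ] (⟦ suc k ∣? N ⟧ * (möbius (N / suc k) * ⟦ suc c ∣? suc k ⟧))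
    ≡⟨ ∑-cong N (λ k → swap ⟦ suc k ∣? N ⟧ (möbius (N / suc k)) ⟦ suc c ∣? suc k ⟧) ⟩
  divisorSum (t ℕ.* suc c) (λ d → ⟦ suc c ∣? d ⟧ * μ/ d)
    ≡⟨ divisorSum-multiples t (suc c) μ/ ⟩
  ∑[ k < t ] (⟦ suc k ∣? t ⟧ * möbius (N / (suc k ℕ.* suc c)))
    ≡⟨ ∑-cong t (λ k → cong (λ x → ⟦ suc k ∣? t ⟧ * möbius x) (m*n/o*n≡m/o t (suc c) (suc k))) ⟩
  ∑[ k < t ] (⟦ suc k ∣? t ⟧ * möbius (t / suc k))
    ≡⟨ divisorSum-cofactor t möbius ⟩
  divisorSum t möbius
    ≡⟨ divisorSum-möbius t ⟩
  ⟦ t ℕ.≟ 1 ⟧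
    ≡⟨ ⟦⟧-⇔ (λ t≡1 → sym (trans (cong (ℕ._* suc c) t≡1) (ℕ.*-identityˡ (suc c))))
       (λ c≡t*c → ℕ.*-cancelʳ-≡ t 1 (suc c) (trans (sym c≡t*c) (sym (ℕ.*-identityˡ (suc c)))))
       (t ℕ.≟ 1) (suc c ℕ.≟ N) ⟩
  ⟦ suc c ℕ.≟ N ⟧ ∎
  where
  μ/ : ℕ → ℤ
  μ/ zero    = + 0 -- junk value, never reached: divisors are positive
  μ/ (suc d) = möbius (N / suc d)
  swap : ∀ x m y → x * (m * y) ≡ x * (y * m)
  swap = solve-∀

möbius-inversion : ∀ N .{{_ : NonZero N}} (b : ℕ → ℤ) → möbiusTransform N (λ d → divisorSum d b) ≡ b N
möbius-inversion N b = begin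
  ∑[ j < N ] (⟦ suc j ∣? N ⟧ * (möbius (N / suc j) * divisorSum (suc j) b))
    ≡⟨ ∑-cong< N (λ j j<N → expand j (widen j j<N)) ⟩
  ∑[ j < N ] ∑[ k < N ] (weight j k * b (suc k))
    ≡⟨ ∑-comm N N (λ j k → weight j k * b (suc k)) ⟩
  ∑[ k < N ] ∑[ j < N ] (weight j k * b (suc k))
    ≡⟨ ∑-cong N (λ k → sym (*-distribʳ-∑ N (b (suc k)) (λ j → weight j k))) ⟩
  ∑[ k < N ] (∑[ j < N ] weight j k * b (suc k))
    ≡⟨ ∑-cong N (λ k → cong (_* b (suc k)) (möbius-over-multiples N k)) ⟩
  ∑[ k < N ] (⟦ suc k ℕ.≟ N ⟧ * b (suc k))
    ≡⟨ ∑-concentrated N (N ∸ 1) N-1<N off ⟩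
  ⟦ suc (N ∸ 1) ℕ.≟ N ⟧ * b (suc (N ∸ 1))
    ≡⟨ cong (λ n → ⟦ n ℕ.≟ N ⟧ * b n) 1+[N-1]≡N ⟩
  ⟦ N ℕ.≟ N ⟧ * b N
    ≡⟨ cong (_* b N) (⟦⟧-yes refl (N ℕ.≟ N)) ⟩
  + 1 * b N
    ≡⟨ ℤ.*-identityˡ (b N) ⟩
  b N ∎
  where
  weight : ℕ → ℕ → ℤ
  weight j k = ⟦ suc j ∣? N ⟧ * (möbius (N / suc j) * ⟦ suc k ∣? suc j ⟧)
  1+[N-1]≡N : suc (N ∸ 1) ≡ N
  1+[N-1]≡N = ℕ.suc-pred N
  N-1<N : N ∸ 1 < N
  N-1<N = ℕ.≤-reflexive 1+[N-1]≡N
  off : ∀ k → k < N → k ≢ N ∸ 1 → ⟦ suc k ℕ.≟ N ⟧ * b (suc k) ≡ + 0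
  off k _ k≢N-1 = cong (_* b (suc k))
                       (⟦⟧-no (λ k+1≡N → k≢N-1 (ℕ.suc-injective (trans k+1≡N (sym 1+[N-1]≡N)))) (suc k ℕ.≟ N))
  widen : ∀ j → j < N → divisorSum (suc j) b ≡ ∑[ k < N ] (⟦ suc k ∣? suc j ⟧ * b (suc k))
  widen j j<N = sym (∑-truncate (suc j) N j<N (λ k j<k _ → cong (_* b (suc k)) (⟦∣?⟧-> (s≤s j<k))))
  expand : ∀ j {x} → x ≡ ∑[ k < N ] (⟦ suc k ∣? suc j ⟧ * b (suc k)) →
           ⟦ suc j ∣? N ⟧ * (möbius (N / suc j) * x) ≡ ∑[ k < N ] (weight j k * b (suc k))
  expand j refl = begin
    ⟦ suc j ∣? N ⟧ * (möbius (N / suc j) * ∑[ k < N ] (⟦ suc k ∣? suc j ⟧ * b (suc k)))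
      ≡⟨ cong (⟦ suc j ∣? N ⟧ *_) (*-distribˡ-∑ N (möbius (N / suc j)) _) ⟩
    ⟦ suc j ∣? N ⟧ * ∑[ k < N ] (möbius (N / suc j) * (⟦ suc k ∣? suc j ⟧ * b (suc k)))
      ≡⟨ *-distribˡ-∑ N ⟦ suc j ∣? N ⟧ _ ⟩
    ∑[ k < N ] (⟦ suc j ∣? N ⟧ * (möbius (N / suc j) * (⟦ suc k ∣? suc j ⟧ * b (suc k))))
      ≡⟨ ∑-cong N (λ k → regroup ⟦ suc j ∣? N ⟧ (möbius (N / suc j)) ⟦ suc k ∣? suc j ⟧ (b (suc k))) ⟩
    ∑[ k < N ] (weight j k * b (suc k))  ∎
    where
    regroup : ∀ x m y z → x * (m * (y * z)) ≡ x * (m * y) * z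
    regroup = solve-∀

möbiusPowerSum≡möbiusTransform : ∀ s N → möbiusPowerSum s N ≡ möbiusTransform N (powerSum s)
möbiusPowerSum≡möbiusTransform s N =
  trans (foldr-+-applyUpTo (λ k → if does (suc k ∣? N) then term k else + 0) id N)
        (∑-cong N (λ k → if-does≡⟦⟧ (suc k ∣? N) (term k)))
  where
  term : ℕ → ℤ
  term k = möbius (N / suc k) * powerSum s (suc k)

möbiusTransform-cong : ∀ N (F G : ℕ → ℤ) → (∀ d → F (suc d) ≡ G (suc d)) → möbiusTransform N F ≡ möbiusTransform N G
möbiusTransform-cong N F G eq = ∑-cong N (λ k → cong (λ x → ⟦ suc k ∣? N ⟧ * (möbius (N / suc k) * x)) (eq k))

dimSDlog-divisorSum : ∀ v e → sgn (suc (suc e)) * dimSDlog v (suc e) ≡ divisorSum (suc e) (λ i → sgn (suc i) * + (i ℕ.* v i))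
dimSDlog-divisorSum v e =
  trans (*-distribˡ-∑ (suc e) (sgn (suc (suc e))) (λ k → factorDlog (v (suc k)) k (suc e))) (∑-cong (suc e) term)
  where
  term : ∀ k → sgn (suc (suc e)) * factorDlog (v (suc k)) k (suc e) ≡
               ⟦ suc k ∣? suc e ⟧ * (sgn (suc (suc k)) * + (suc k ℕ.* v (suc k)))
  term k = begin
    sgn (suc (suc e)) * (⟦ suc k ∣? suc e ⟧ * (sgn (suc e ℕ.+ suc k) * X))
      ≡⟨ cong (λ x → sgn (suc (suc e)) * (⟦ suc k ∣? suc e ⟧ * (x * X))) (sgn-+ (suc e) (suc k)) ⟩
    sgn (suc (suc e)) * (⟦ suc k ∣? suc e ⟧ * (sgn (suc e) * sgn (suc k) * X))
      ≡⟨ regroup (sgn (suc e)) ⟦ suc k ∣? suc e ⟧ (sgn (suc k)) X ⟩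
    ⟦ suc k ∣? suc e ⟧ * (- sgn (suc k) * X) * (sgn (suc e) * sgn (suc e))
      ≡⟨ cong (⟦ suc k ∣? suc e ⟧ * (- sgn (suc k) * X) *_) (sgn*sgn≡1 (suc e)) ⟩
    ⟦ suc k ∣? suc e ⟧ * (- sgn (suc k) * X) * + 1
      ≡⟨ ℤ.*-identityʳ _ ⟩
    ⟦ suc k ∣? suc e ⟧ * (sgn (suc (suc k)) * X) ∎
    where
    X : ℤ
    X = + (suc k ℕ.* v (suc k))
    regroup : ∀ g d h x → (- g) * (d * (g * h * x)) ≡ d * (- h * x) * (g * g)
    regroup = solve-∀

powerSum-dimS : ∀ v s → (∀ n → 1 ≤ n → s n ≡ + dimS v n) →
                ∀ e → powerSum s (suc e) ≡ divisorSum (suc e) (λ i → sgn (suc i) * + (i ℕ.* v i))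
powerSum-dimS v s s≡dimS e =
  trans (powerSum-logarithmic (+_ ∘ dimS v) (dimSDlog v) s refl (dimS-logarithmic v) s≡dimS (suc e) (s≤s z≤n))
        (dimSDlog-divisorSum v e)

mainTheorem3 : (v : ℕ → ℕ) (s : ℕ → ℤ)
    → (∀ n → 1 ≤ n → s n ≡ + dimS v n)
    → ∀ (N : ℕ) → 1 ≤ N
    → + 0 ≤ℤ sgn (Data.Nat.suc N) * möbiusPowerSum s N
mainTheorem3 v s s≡dimS N 1≤N = subst (+ 0 ≤ℤ_) (sym N·v[N]) (ℤ.+≤+ z≤n)
  where
  instance
    N≢0 : NonZero N
    N≢0 = ℕ.>-nonZero 1≤N
  b : ℕ → ℤ
  b i = sgn (suc i) * + (i ℕ.* v i)
  N·v[N] : sgn (suc N) * möbiusPowerSum s N ≡ + (N ℕ.* v N)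
  N·v[N] = begin
    sgn (suc N) * möbiusPowerSum s N
      ≡⟨ cong (sgn (suc N) *_) (möbiusPowerSum≡möbiusTransform s N) ⟩
    sgn (suc N) * möbiusTransform N (powerSum s)
      ≡⟨ cong (sgn (suc N) *_) (möbiusTransform-cong N (powerSum s) (λ d → divisorSum d b) (powerSum-dimS v s s≡dimS)) ⟩
    sgn (suc N) * möbiusTransform N (λ d → divisorSum d b)
      ≡⟨ cong (sgn (suc N) *_) (möbius-inversion N b) ⟩
    sgn (suc N) * (sgn (suc N) * + (N ℕ.* v N))
      ≡⟨ sym (ℤ.*-assoc (sgn (suc N)) (sgn (suc N)) _) ⟩
    sgn (suc N) * sgn (suc N) * + (N ℕ.* v N)
      ≡⟨ cong (_* + (N ℕ.* v N)) (sgn*sgn≡1 (suc N)) ⟩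
    + 1 * + (N ℕ.* v N)
      ≡⟨ ℤ.*-identityˡ _ ⟩
    + (N ℕ.* v N) ∎
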